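{- There are deterministic, stateless $\mathrm{CentLocal}[\Delta^{O(\Delta^2)}\cdot \log^* n]$-algorithms for $(\Delta+1)$-vertex coloring, for maximal independent set, and for maximal matching.
   Context: Graphs are undirected and labeled: $n$ vertices with distinct IDs in $\{1,\dots,n\}$, each vertex $v$ has ports $1,\dots,\deg(v)$ pointing to its neighbors in an arbitrary fixed way; $\Delta$ is the maximum degree. In the CentLocal model an algorithm knows $n,\Delta$ and accesses the graph only via probes $(v,i)$ returning the $i$-th neighbor of $v$ (and the port number of $v$ at that neighbor), or null if $i>\deg(v)$. It receives an online sequence of queries (vertices, e.g. "what is the color of $v$?" / "is $v$ in the independent set?", or edges for matching) and must be consistent: there is one fixed solution (a legal $(\Delta+1)$-coloring, a maximal independent set, or a maximal matching) such that every answer to every query in every query sequence agrees with it. $\mathrm{CentLocal}[q]$ means consistent with at most $q$ probes per query; stateless means no information is stored between queries. -}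

module Defs where

open import Data.Nat using (ℕ; zero; suc; _+_; _*_; _^_; _≤_; _<_)
open import Data.Nat.Properties using (_<?_; _≤?_)
open import Data.Nat.Logarithm using (⌊log₂_⌋)
open import Data.Fin using (Fin; toℕ; fromℕ<)
open import Data.Bool using (Bool; true; false)
open import Data.Maybe using (Maybe; just; nothing)
open import Data.Product using (_×_; _,_; ∃-syntax)
open import Data.Sum using (_⊎_)
open import Relation.Nullary using (yes; no; ¬_)
open import Relation.Binary.PropositionalEquality using (_≡_; _≢_)

-- Port-numbered simple undirected graphs on the vertex (ID) set Fin n.
-- Vertex v has ports 0 .. deg v - 1 (internally); port i of v leads to
-- nbr v i, and back v i is the port of v at that neighbour.

record Graph (n : ℕ) : Set where
  field
    deg       : Fin n → ℕ
    nbr       : (v : Fin n) → Fin (deg v) → Fin n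
    back      : (v : Fin n) (i : Fin (deg v)) → Fin (deg (nbr v i))
    nbr-back  : ∀ v i → nbr (nbr v i) (back v i) ≡ v
    back-back : ∀ v i → toℕ (back (nbr v i) (back v i)) ≡ toℕ i
    loopless  : ∀ v i → nbr v i ≢ v
    simple    : ∀ v i j → nbr v i ≡ nbr v j → i ≡ j

open Graph public

-- Δ is the maximum degree of G: every degree is ≤ Δ and (if the graph
-- is nonempty) some vertex has degree exactly Δ.
MaxDegree : ∀ {n} → Graph n → ℕ → Set
MaxDegree {n} G Δ = (∀ v → deg G v ≤ Δ) × ((v : Fin n) → ∃[ u ] deg G u ≡ Δ)

-- The probe (v, i) with 1-based port numbers i = 1 .. deg v, as in the
-- paper: returns the i-th neighbour of v together with the (1-based)
-- port number of v at that neighbour, or null (nothing) if i > deg v.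
probeG : ∀ {n} → Graph n → Fin n → ℕ → Maybe (Fin n × ℕ)
probeG G v zero = nothing
probeG G v (suc k) with k <? deg G v
... | yes p = just (nbr G v (fromℕ< p) , suc (toℕ (back G v (fromℕ< p))))
... | no _  = nothing

-- A deterministic adaptive probing procedure answering one query:
-- a decision tree whose internal nodes are probes.

data Probing (n : ℕ) (A : Set) : Set where
  answer : A → Probing n A
  probe  : Fin n → ℕ → (Maybe (Fin n × ℕ) → Probing n A) → Probing n A

run : ∀ {n A} → Graph n → Probing n A → A
run G (answer a)    = a
run G (probe v i k) = run G (k (probeG G v i))

probes : ∀ {n A} → Graph n → Probing n A → ℕ
probes G (answer a)    = 0
probes G (probe v i k) = suc (probes G (k (probeG G v i)))

-- Deterministic stateless CentLocal algorithms: knowing n and Δ, each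
-- query is answered by a probing procedure depending only on (n, Δ, query).

ColoringAlg : Set
ColoringAlg = (n Δ : ℕ) → Fin n → Probing n (Fin (suc Δ))

MISAlg : Set
MISAlg = (n Δ : ℕ) → Fin n → Probing n Bool

-- edge queries are given by their two endpoints (u, v)
MatchingAlg : Set
MatchingAlg = (n Δ : ℕ) → Fin n → Fin n → Probing n Bool

IsLegalColoring : ∀ {n k} → Graph n → (Fin n → Fin k) → Set
IsLegalColoring G col = ∀ v i → col v ≢ col (nbr G v i)

IsMIS : ∀ {n} → Graph n → (Fin n → Bool) → Set
IsMIS G S =
  (∀ v i → S v ≡ true → S (nbr G v i) ≡ false) ×
  (∀ v → S v ≡ false → ∃[ i ] S (nbr G v i) ≡ true)

-- M u v = true means the edge {u,v} is in the matching (only values on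
-- edges matter).
IsMaximalMatching : ∀ {n} → Graph n → (Fin n → Fin n → Bool) → Set
IsMaximalMatching G M =
  (∀ u i → M u (nbr G u i) ≡ M (nbr G u i) u) ×
  (∀ u i j → M u (nbr G u i) ≡ true → M u (nbr G u j) ≡ true → i ≡ j) ×
  (∀ u i → M u (nbr G u i) ≡ false →
      (∃[ j ] M u (nbr G u j) ≡ true) ⊎
      (∃[ j ] M (nbr G u i) (nbr G (nbr G u i) j) ≡ true))

-- Consistency: since the algorithm is deterministic and stateless, the
-- answer to a query does not depend on earlier queries, so consistency
-- over all query sequences means the answer function is itself a
-- legal solution.

ColoringCorrect : ColoringAlg → Set
ColoringCorrect A = ∀ n Δ (G : Graph n) → MaxDegree G Δ →
  IsLegalColoring G (λ v → run G (A n Δ v))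

MISCorrect : MISAlg → Set
MISCorrect A = ∀ n Δ (G : Graph n) → MaxDegree G Δ →
  IsMIS G (λ v → run G (A n Δ v))

MatchingCorrect : MatchingAlg → Set
MatchingCorrect A = ∀ n Δ (G : Graph n) → MaxDegree G Δ →
  IsMaximalMatching G (λ u v → run G (A n Δ u v))

-- log* n : number of times ⌊log₂⌋ must be iterated starting from n
-- until the value is ≤ 1 (fuel n suffices since ⌊log₂ m⌋ < m for m ≥ 2).

logStarAux : ℕ → ℕ → ℕ
logStarAux zero     m = 0
logStarAux (suc f)  m with m ≤? 1
... | yes _ = 0
... | no  _ = suc (logStarAux f ⌊log₂ m ⌋)

log* : ℕ → ℕ
log* n = logStarAux n n

-- The bound Δ^{O(Δ²)} · log* n with an explicit constant c, written
-- c · (Δ+1)^{c·Δ²} · (1 + log* n) so that it is meaningful also in the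
-- degenerate cases Δ ≤ 1 or n ≤ 1.
bound : ℕ → ℕ → ℕ → ℕ
bound c n Δ = c * (suc Δ) ^ (c * (Δ * Δ)) * suc (log* n)

ColoringProbes≤ : ColoringAlg → (ℕ → ℕ → ℕ) → Set
ColoringProbes≤ A f = ∀ n Δ (G : Graph n) → MaxDegree G Δ →
  ∀ v → probes G (A n Δ v) ≤ f n Δ

MISProbes≤ : MISAlg → (ℕ → ℕ → ℕ) → Set
MISProbes≤ A f = ∀ n Δ (G : Graph n) → MaxDegree G Δ →
  ∀ v → probes G (A n Δ v) ≤ f n Δ

-- only edge queries are legal, so the bound is required for edges
MatchingProbes≤ : MatchingAlg → (ℕ → ℕ → ℕ) → Set
MatchingProbes≤ A f = ∀ n Δ (G : Graph n) → MaxDegree G Δ →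
  ∀ u i → probes G (A n Δ u (nbr G u i)) ≤ f n Δ

-- Each algorithm simulates a synchronous distributed algorithm: a round in which every vertex reads the
-- states of its ≤ Δ neighbours multiplies the probe count by Δ + 1, so t rounds cost (Δ + 1)^t times the
-- cost of the initial states. The ports split the edges into Δ oriented forests (in forest j a vertex
-- points to its port-j neighbour if that has a larger ID), and on a forest Cole–Vishkin turns the IDs
-- into a proper 8-colouring in O(log* n) rounds; a vertex's colour depends only on its O(log* n)
-- ancestors, which a query reaches by walking up the forest. Merging the forests one at a time, by
-- pairing the current (Δ + 1)-colouring with the forest's 8-colouring and then recolouring the
-- largest colour class greedily 7(Δ + 1) times, gives a proper (Δ + 1)-colouring after O(Δ²) rounds,
-- hence Δ^O(Δ²) · log* n probes. From it a maximal independent set takes Δ + 1 more rounds (colour r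
-- joins in round r) and a maximal matching 2Δ(Δ + 1) more (in phase (x, j) the free vertices of
-- colour x propose through port j).

module Submission where

open import Defs
open import Data.Bool using (Bool; true; false)
import Data.Bool.Properties as Bool
open import Data.Empty using (⊥)
open import Data.Fin using (Fin; toℕ; fromℕ<; inject≤)
import Data.Fin as Fin
open import Data.Fin.Properties using (toℕ<n; toℕ-injective; toℕ-inject≤; fromℕ<-toℕ; toℕ-fromℕ<; any?; pigeonhole)
open import Data.List using (List; []; _∷_)
open import Data.Maybe using (Maybe; just; nothing; maybe′)
import Data.Maybe as Maybe
import Data.Maybe.Properties as Maybe
open import Data.Nat
open import Data.Nat.DivMod using (_/_; _%_; _mod_; m%n<n; m≡m%n+[m/n]*n; m/n<m; m/n≤m; m<n*o⇒m/o<n; [m+kn]%n≡m%n; m<n⇒m%n≡m)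
open import Data.Nat.GeneralisedArithmetic using (iterate)
open import Data.Nat.Induction using (<-wellFounded)
open import Data.Nat.Logarithm using (⌊log₂_⌋; ⌊log₂⌋-mono-≤)
open import Data.Nat.Logarithm.Core using (⌊log2⌋)
open import Data.Nat.Properties
open import Data.Nat.Tactic.RingSolver using (solve-∀)
open import Data.Product using (_×_; _,_; proj₁; proj₂; Σ; ∃; ∃-syntax; map₁; map₂)
open import Data.Sum using (_⊎_; inj₁; inj₂; [_,_]′)
import Data.Sum as Sum
open import Data.Vec using (Vec; []; _∷_; lookup; tabulate)
import Data.Vec as Vec
open import Data.Vec.Properties using (lookup-map; lookup∘tabulate)
open import Function using (_∘_; mk⇔)
open import Induction.WellFounded using (Acc; acc)
open import Relation.Nullary using (Dec; yes; no; ¬_; ¬?; does; contradiction)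
open import Relation.Nullary.Decidable using (_×-dec_; dec-true; decidable-stable)
open import Relation.Binary.PropositionalEquality

private variable
  n : ℕ
  A B S X : Set

infixl 1 _>>=_
infixl 4 _<$>_

_>>=_ : Probing n A → (A → Probing n B) → Probing n B
answer a    >>= f = f a
probe v i k >>= f = probe v i (λ r → k r >>= f)

_<$>_ : (A → B) → Probing n A → Probing n B
f <$> m = m >>= λ a → answer (f a)

module _ (G : Graph n) where

  run->>= : (m : Probing n A) (f : A → Probing n B) → run G (m >>= f) ≡ run G (f (run G m))
  run->>= (answer a)    f = refl
  run->>= (probe v i k) f = run->>= (k (probeG G v i)) f

  probes->>= : (m : Probing n A) (f : A → Probing n B) →
               probes G (m >>= f) ≡ probes G m + probes G (f (run G m))
  probes->>= (answer a)    f = refl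
  probes->>= (probe v i k) f = cong suc (probes->>= (k (probeG G v i)) f)

  run-<$> : (f : A → B) (m : Probing n A) → run G (f <$> m) ≡ f (run G m)
  run-<$> f m = run->>= m _

  probes-<$> : (f : A → B) (m : Probing n A) → probes G (f <$> m) ≡ probes G m
  probes-<$> f m = trans (probes->>= m _) (+-identityʳ (probes G m))

sequenceP : ∀ k → (ℕ → Probing n X) → Probing n (Vec X k)
sequenceP zero    f = answer []
sequenceP (suc k) f = f 0 >>= λ x → (x ∷_) <$> sequenceP k (f ∘ suc)

module _ (G : Graph n) where

  run-sequenceP : ∀ k (f : ℕ → Probing n X) (g : ℕ → X) → (∀ i → run G (f i) ≡ g i) →
                  run G (sequenceP k f) ≡ tabulate (g ∘ toℕ)
  run-sequenceP zero    f g f≡g = refl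
  run-sequenceP (suc k) f g f≡g = begin
    run G (sequenceP (suc k) f)                        ≡⟨ run->>= G (f 0) _ ⟩
    run G ((run G (f 0) ∷_) <$> sequenceP k (f ∘ suc)) ≡⟨ run-<$> G _ (sequenceP k (f ∘ suc)) ⟩
    run G (f 0) ∷ run G (sequenceP k (f ∘ suc))        ≡⟨ cong₂ _∷_ (f≡g 0) (run-sequenceP k (f ∘ suc) (g ∘ suc) (f≡g ∘ suc)) ⟩
    g 0 ∷ tabulate (g ∘ suc ∘ toℕ)                     ∎
    where open ≡-Reasoning

  probes-sequenceP : ∀ k (f : ℕ → Probing n X) {c} → (∀ i → probes G (f i) ≤ c) →
                     probes G (sequenceP k f) ≤ k * c
  probes-sequenceP zero    f f≤c = z≤n
  probes-sequenceP (suc k) f {c} f≤c = begin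
    probes G (sequenceP (suc k) f)
      ≡⟨ probes->>= G (f 0) _ ⟩
    probes G (f 0) + probes G ((run G (f 0) ∷_) <$> sequenceP k (f ∘ suc))
      ≡⟨ cong (probes G (f 0) +_) (probes-<$> G _ _) ⟩
    probes G (f 0) + probes G (sequenceP k (f ∘ suc))
      ≤⟨ +-mono-≤ (f≤c 0) (probes-sequenceP k (f ∘ suc) (f≤c ∘ suc)) ⟩
    c + k * c ∎
    where open ≤-Reasoning

at : A → Vec A n → ℕ → A
at d []       _       = d
at d (x ∷ xs) zero    = x
at d (x ∷ xs) (suc i) = at d xs i

at-tabulate : ∀ {k} (d : A) (g : ℕ → A) {i} → i < k → at d (tabulate {n = k} (g ∘ toℕ)) i ≡ g i
at-tabulate d g {zero}  (s≤s _)   = refl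
at-tabulate d g {suc i} (s≤s i<n) = at-tabulate d (g ∘ suc) i<n

at-lookup : ∀ (d : A) (xs : Vec A n) j → at d xs (toℕ j) ≡ lookup xs j
at-lookup d (x ∷ xs) Fin.zero    = refl
at-lookup d (x ∷ xs) (Fin.suc j) = at-lookup d xs j

at-just⇒< : ∀ (xs : Vec (Maybe A) n) {i x} → at nothing xs i ≡ just x → i < n
at-just⇒< (x ∷ xs) {zero}  _  = s≤s z≤n
at-just⇒< (x ∷ xs) {suc i} eq = s≤s (at-just⇒< xs eq)

at-∀ : ∀ {P : A → Set} {d} (xs : Vec A n) → P d → (∀ j → P (lookup xs j)) → ∀ k → P (at d xs k)
at-∀         []       Pd Pxs k       = Pd
at-∀         (x ∷ xs) Pd Pxs zero    = Pxs Fin.zero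
at-∀ {P = P} (x ∷ xs) Pd Pxs (suc k) = at-∀ {P = P} xs Pd (Pxs ∘ Fin.suc) k

module _ (G : Graph n) where

  probeG-port : ∀ v (i : Fin (deg G v)) →
                probeG G v (suc (toℕ i)) ≡ just (nbr G v i , suc (toℕ (back G v i)))
  probeG-port v i with toℕ i <? deg G v
  ... | yes p rewrite fromℕ<-toℕ i p = refl
  ... | no ¬p = contradiction (toℕ<n i) ¬p

  probeG-just : ∀ v k {w b} → probeG G v (suc k) ≡ just (w , b) →
                Σ (Fin (deg G v)) λ i → toℕ i ≡ k × w ≡ nbr G v i × b ≡ suc (toℕ (back G v i))
  probeG-just v k eq with k <? deg G v
  probeG-just v k refl | yes p = fromℕ< p , toℕ-fromℕ< p , refl , refl

-- entry k: the state of the neighbour behind port k (counted from 0) and the port (counted from 1) leading back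
View : Set → ℕ → Set
View S Δ = Vec (Maybe (S × ℕ)) Δ

Round : Set → ℕ → Set
Round S Δ = ℕ → S → View S Δ → S

module _ (G : Graph n) where

  seen : (Fin n → S) → Fin n → ℕ → Maybe (S × ℕ)
  seen s v k = Maybe.map (map₁ s) (probeG G v (suc k))

  viewG : ∀ Δ → (Fin n → S) → Fin n → View S Δ
  viewG Δ s v = tabulate (seen s v ∘ toℕ)

  rounds : ∀ {Δ} → Round S Δ → (Fin n → S) → ℕ → Fin n → S
  rounds step s₀ zero    v = s₀ v
  rounds step s₀ (suc t) v = step t (rounds step s₀ t v) (viewG _ (rounds step s₀ t) v)

  module _ {Δ} {s : Fin n → S} (Δ≥deg : ∀ v → deg G v ≤ Δ) where

    view-port : ∀ v (i : Fin (deg G v)) →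
                at nothing (viewG Δ s v) (toℕ i) ≡ just (s (nbr G v i) , suc (toℕ (back G v i)))
    view-port v i = trans (at-tabulate nothing (seen s v) (≤-trans (toℕ<n i) (Δ≥deg v)))
                          (cong (Maybe.map (map₁ s)) (probeG-port G v i))

    lookup-view-port : ∀ v (i : Fin (deg G v)) →
                       lookup (viewG Δ s v) (inject≤ i (Δ≥deg v)) ≡ just (s (nbr G v i) , suc (toℕ (back G v i)))
    lookup-view-port v i = begin
      lookup (viewG Δ s v) (inject≤ i (Δ≥deg v))         ≡⟨ sym (at-lookup nothing (viewG Δ s v) _) ⟩
      at nothing (viewG Δ s v) (toℕ (inject≤ i (Δ≥deg v))) ≡⟨ cong (at nothing (viewG Δ s v)) (toℕ-inject≤ i _) ⟩
      at nothing (viewG Δ s v) (toℕ i)                    ≡⟨ view-port v i ⟩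
      just (s (nbr G v i) , suc (toℕ (back G v i)))       ∎
      where open ≡-Reasoning

  seen-just : ∀ (s : Fin n → S) v k {x b} → seen s v k ≡ just (x , b) →
              Σ (Fin (deg G v)) λ i → toℕ i ≡ k × x ≡ s (nbr G v i) × b ≡ suc (toℕ (back G v i))
  seen-just s v k eq with probeG G v (suc k) in probe≡
  seen-just s v k refl | just (w , b) with probeG-just G v k probe≡
  ... | i , i≡k , refl , refl = i , i≡k , refl , refl

  view-just : ∀ {Δ} (s : Fin n → S) v k {x b} → at nothing (viewG Δ s v) k ≡ just (x , b) →
              Σ (Fin (deg G v)) λ i → toℕ i ≡ k × x ≡ s (nbr G v i) × b ≡ suc (toℕ (back G v i))
  view-just {Δ = Δ} s v k eq =
    seen-just s v k (trans (sym (at-tabulate {k = Δ} nothing (seen s v) (at-just⇒< (viewG Δ s v) eq))) eq)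

  lookup-view-just : ∀ {Δ} (s : Fin n → S) v j {x b} → lookup (viewG Δ s v) j ≡ just (x , b) →
                     Σ (Fin (deg G v)) λ i → toℕ i ≡ toℕ j × x ≡ s (nbr G v i) × b ≡ suc (toℕ (back G v i))
  lookup-view-just {Δ = Δ} s v j eq = view-just {Δ = Δ} s v (toℕ j) (trans (at-lookup nothing (viewG Δ s v) j) eq)

seenVia : (Fin n → Probing n S) → Maybe (Fin n × ℕ) → Probing n (Maybe (S × ℕ))
seenVia sP nothing        = answer nothing
seenVia sP (just (w , b)) = (λ x → just (x , b)) <$> sP w

seenP : (Fin n → Probing n S) → Fin n → ℕ → Probing n (Maybe (S × ℕ))
seenP sP v k = probe v (suc k) (seenVia sP)

roundsP : ∀ {Δ} → Round S Δ → (Fin n → Probing n S) → ℕ → Fin n → Probing n S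
roundsP step s₀ zero    v = s₀ v
roundsP step s₀ (suc t) v =
  roundsP step s₀ t v >>= λ s → step t s <$> sequenceP _ (seenP (roundsP step s₀ t) v)

module _ (G : Graph n) {sP : Fin n → Probing n S} where

  run-seenP : ∀ {s} → (∀ w → run G (sP w) ≡ s w) → ∀ v k → run G (seenP sP v k) ≡ seen G s v k
  run-seenP {s} sP≡s v k = go (probeG G v (suc k))
    where
    go : ∀ r → run G (seenVia sP r) ≡ Maybe.map (map₁ s) r
    go nothing        = refl
    go (just (w , b)) = trans (run-<$> G _ (sP w)) (cong (λ x → just (x , b)) (sP≡s w))

  probes-seenP : ∀ {c} → 1 ≤ c → (∀ w → suc (probes G (sP w)) ≤ c) → ∀ v k → probes G (seenP sP v k) ≤ c
  probes-seenP {c} 1≤c sP≤c v k = go (probeG G v (suc k))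
    where
    go : ∀ r → suc (probes G (seenVia sP r)) ≤ c
    go nothing        = 1≤c
    go (just (w , b)) = subst (λ p → suc p ≤ c) (sym (probes-<$> G _ (sP w))) (sP≤c w)

module _ (G : Graph n) {Δ} (step : Round S Δ) {s₀P : Fin n → Probing n S} where

  run-roundsP : ∀ {s₀} → (∀ v → run G (s₀P v) ≡ s₀ v) →
                ∀ t v → run G (roundsP step s₀P t v) ≡ rounds G step s₀ t v
  run-roundsP s₀≡ zero    v = s₀≡ v
  run-roundsP s₀≡ (suc t) v = begin
    run G (roundsP step s₀P (suc t) v)                        ≡⟨ run->>= G (roundsP step s₀P t v) _ ⟩
    run G (step t (run G (roundsP step s₀P t v)) <$> views)  ≡⟨ run-<$> G _ views ⟩
    step t (run G (roundsP step s₀P t v)) (run G views)       ≡⟨ cong₂ (step t) (run-roundsP s₀≡ t v)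
                                                                   (run-sequenceP G Δ _ _ (run-seenP G (run-roundsP s₀≡ t) v)) ⟩
    rounds G step _ (suc t) v                                 ∎
    where
    open ≡-Reasoning
    views = sequenceP Δ (seenP (roundsP step s₀P t) v)

  probes-roundsP : ∀ {c} → (∀ v → suc (probes G (s₀P v)) ≤ c) →
                   ∀ t v → suc (probes G (roundsP step s₀P t v)) ≤ suc Δ ^ t * c
  probes-roundsP {c} s₀≤c zero    v = subst (suc (probes G (s₀P v)) ≤_) (sym (*-identityˡ c)) (s₀≤c v)
  probes-roundsP {c} s₀≤c (suc t) v
    rewrite probes->>= G (roundsP step s₀P t v) (λ s → step t s <$> sequenceP Δ (seenP (roundsP step s₀P t) v))
          | probes-<$> G (step t (run G (roundsP step s₀P t v))) (sequenceP Δ (seenP (roundsP step s₀P t) v))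
          | *-assoc (suc Δ) (suc Δ ^ t) c
    = +-mono-≤ (probes-roundsP s₀≤c t v)
               (probes-sequenceP G Δ _ (probes-seenP G (≤-trans (s≤s z≤n) (probes-roundsP s₀≤c t v))
                                                       (probes-roundsP s₀≤c t) v))

⌊n/2⌋*2≤n : ∀ k → ⌊ k /2⌋ * 2 ≤ k
⌊n/2⌋*2≤n zero          = z≤n
⌊n/2⌋*2≤n (suc zero)    = z≤n
⌊n/2⌋*2≤n (suc (suc k)) = s≤s (s≤s (⌊n/2⌋*2≤n k))

n≤1+⌊n/2⌋*2 : ∀ k → k ≤ suc (⌊ k /2⌋ * 2)
n≤1+⌊n/2⌋*2 zero          = z≤n
n≤1+⌊n/2⌋*2 (suc zero)    = s≤s z≤n
n≤1+⌊n/2⌋*2 (suc (suc k)) = s≤s (s≤s (n≤1+⌊n/2⌋*2 k))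

module _ where
  open ≤-Reasoning

  <2^suc⌊log2⌋ : ∀ m (a : Acc _<_ m) → m < 2 ^ suc (⌊log2⌋ m a)
  <2^suc⌊log2⌋ zero                _        = s≤s z≤n
  <2^suc⌊log2⌋ (suc zero)          _        = s≤s (s≤s z≤n)
  <2^suc⌊log2⌋ (suc (suc k)) (acc rs) = begin
    3 + k                      ≤⟨ +-monoʳ-≤ 3 (n≤1+⌊n/2⌋*2 k) ⟩
    4 + ⌊ k /2⌋ * 2            ≡⟨ *-comm (2 + ⌊ k /2⌋) 2 ⟩
    2 * (2 + ⌊ k /2⌋)          ≤⟨ *-monoʳ-≤ 2 (<2^suc⌊log2⌋ (suc ⌊ k /2⌋) _) ⟩
    2 * 2 ^ suc (⌊log2⌋ (suc ⌊ k /2⌋) _) ∎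

  2^⌊log2⌋≤ : ∀ m (a : Acc _<_ m) → 1 ≤ m → 2 ^ ⌊log2⌋ m a ≤ m
  2^⌊log2⌋≤ (suc zero)    _        _ = s≤s z≤n
  2^⌊log2⌋≤ (suc (suc k)) (acc rs) _ = begin
    2 * 2 ^ ⌊log2⌋ (suc ⌊ k /2⌋) _ ≤⟨ *-monoʳ-≤ 2 (2^⌊log2⌋≤ (suc ⌊ k /2⌋) _ (s≤s z≤n)) ⟩
    2 * suc ⌊ k /2⌋                ≡⟨ *-comm 2 (suc ⌊ k /2⌋) ⟩
    2 + ⌊ k /2⌋ * 2                ≤⟨ +-monoʳ-≤ 2 (⌊n/2⌋*2≤n k) ⟩
    2 + k                          ∎

  ⌊log2⌋< : ∀ m (a : Acc _<_ m) → 1 ≤ m → ⌊log2⌋ m a < m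
  ⌊log2⌋< (suc zero)    _        _ = s≤s z≤n
  ⌊log2⌋< (suc (suc k)) (acc rs) _ = s≤s (begin-strict
    ⌊log2⌋ (suc ⌊ k /2⌋) _ <⟨ ⌊log2⌋< (suc ⌊ k /2⌋) _ (s≤s z≤n) ⟩
    suc ⌊ k /2⌋            ≤⟨ s≤s (⌊n/2⌋≤n k) ⟩
    suc k                  ∎)

n<2^suc⌊log₂n⌋ : ∀ m → m < 2 ^ suc ⌊log₂ m ⌋
n<2^suc⌊log₂n⌋ m = <2^suc⌊log2⌋ m (<-wellFounded m)

⌊log₂n⌋<n : ∀ {m} → 1 ≤ m → ⌊log₂ m ⌋ < m
⌊log₂n⌋<n {m} = ⌊log2⌋< m (<-wellFounded m)

<2^suc⇒⌊log₂⌋≤ : ∀ {m k} → m < 2 ^ suc k → ⌊log₂ m ⌋ ≤ k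
<2^suc⇒⌊log₂⌋≤ {zero}  _ = z≤n
<2^suc⇒⌊log₂⌋≤ {suc m} {k} m<2^k+1 with ⌊log₂ suc m ⌋ ≤? k
... | yes le = le
... | no  gt = contradiction (≤-trans (^-monoʳ-≤ 2 (≰⇒> gt)) (2^⌊log2⌋≤ (suc m) _ (s≤s z≤n))) (<⇒≱ m<2^k+1)

module _ {A : Set} (f : A → A) where

  iterate-suc : ∀ x k → iterate f x (suc k) ≡ f (iterate f x k)
  iterate-suc x zero    = refl
  iterate-suc x (suc k) = iterate-suc (f x) k

module _ (f : ℕ → ℕ) where

  iterate-mono : (∀ {a b} → a ≤ b → f a ≤ f b) → ∀ k {a b} → a ≤ b → iterate f a k ≤ iterate f b k
  iterate-mono mono zero    a≤b = a≤b
  iterate-mono mono (suc k) a≤b = iterate-mono mono k (mono a≤b)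

  iterate-≤-stable : ∀ {c} → (∀ a → a ≤ c → f a ≤ c) → ∀ k {a} → a ≤ c → iterate f a k ≤ c
  iterate-≤-stable stable zero    a≤c = a≤c
  iterate-≤-stable stable (suc k) a≤c = iterate-≤-stable stable k (stable _ a≤c)

-- one Cole–Vishkin round turns colours below m into colours below cvRange m
cvRange : ℕ → ℕ
cvRange m = suc ⌊log₂ m ⌋ * 2

cvRange≤ : ∀ {m} k → m < 2 ^ suc k → cvRange m ≤ suc k * 2
cvRange≤ k m<2^k+1 = *-monoˡ-≤ 2 (s≤s (<2^suc⇒⌊log₂⌋≤ {k = k} m<2^k+1))

cvRange-mono : ∀ {m m'} → m ≤ m' → cvRange m ≤ cvRange m'
cvRange-mono m≤m' = *-monoˡ-≤ 2 (s≤s (⌊log₂⌋-mono-≤ m≤m'))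

iterate-cvRange-small : ∀ {m} → m < 4096 → ∀ k → 3 ≤ k → iterate cvRange m k ≤ 8
iterate-cvRange-small _ zero             ()
iterate-cvRange-small _ (suc zero)       (s≤s ())
iterate-cvRange-small _ (suc (suc zero)) (s≤s (s≤s ()))
iterate-cvRange-small {m} m<2^12 (suc (suc (suc k))) _ = iterate-≤-stable cvRange ≤8-stable k cvRange³≤8
  where
  ≤8-stable : ∀ a → a ≤ 8 → cvRange a ≤ 8
  ≤8-stable a a≤8 = cvRange≤ 3 (s≤s (≤-trans a≤8 (m≤m+n 8 7)))
  cvRange³≤8 : cvRange (cvRange (cvRange m)) ≤ 8
  cvRange³≤8 = cvRange≤ 3 (s≤s (≤-trans (cvRange≤ 4 (s≤s (≤-trans (cvRange≤ 11 m<2^12) (m≤m+n 24 7))))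
                                        (m≤m+n 10 5)))

q*4+4<2^q : ∀ q → 6 ≤ q → q * 4 + 4 < 2 ^ q
q*4+4<2^q (suc q) (s≤s 5≤q) with m≤n⇒m<n∨m≡n 5≤q
... | inj₂ refl = s≤s (m≤m+n 28 35)
... | inj₁ 6≤q  = begin-strict
  (1 + q) * 4 + 4         ≡⟨ cong (_+ 4) (+-comm 4 (q * 4)) ⟩
  (q * 4 + 4) + 4         <⟨ +-mono-<-≤ (q*4+4<2^q q 6≤q) (≤-trans (m≤n+m 4 (q * 4)) (<⇒≤ (q*4+4<2^q q 6≤q))) ⟩
  2 ^ q + 2 ^ q           ≡⟨ cong (2 ^ q +_) (sym (+-identityʳ (2 ^ q))) ⟩
  2 * 2 ^ q               ∎
  where open ≤-Reasoning

cvRange²≤ : ∀ m q → 6 ≤ q → ⌊log₂ m ⌋ ≤ suc (q * 2) → cvRange (cvRange m) ≤ q * 2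
cvRange²≤ m q@(suc k) 6≤q log≤ = cvRange≤ k (begin-strict
  suc ⌊log₂ m ⌋ * 2   ≤⟨ *-monoˡ-≤ 2 (s≤s log≤) ⟩
  (2 + q * 2) * 2     ≡⟨ *-distribʳ-+ 2 2 (q * 2) ⟩
  4 + q * 2 * 2       ≡⟨ cong (4 +_) (*-assoc q 2 2) ⟩
  4 + q * 4           ≡⟨ +-comm 4 (q * 4) ⟩
  q * 4 + 4           <⟨ q*4+4<2^q q 6≤q ⟩
  2 ^ q               ∎)
  where open ≤-Reasoning

-- Once ⌊log₂ m⌋ ≥ 12, two rounds shrink the bound m to at most ⌊log₂ m⌋; below 2^12 three rounds reach 8.
-- (The count is k * 2 + 3 rather than 3 + k * 2 so that it stays neutral and the iterates are never unfolded.)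
iterate-cvRange-log* : ∀ f m → m ≤ f → iterate cvRange m (logStarAux f m * 2 + 3) ≤ 8
iterate-cvRange-log* zero    zero _   = iterate-cvRange-small (s≤s z≤n) 3 ≤-refl
iterate-cvRange-log* (suc f) m    m≤f with m ≤? 1
... | yes m≤1 = iterate-cvRange-small (s≤s (≤-trans m≤1 (m≤m+n 1 4094))) 3 ≤-refl
... | no  m≰1 = by-size (12 ≤? L)
  where
  L = ⌊log₂ m ⌋
  L≤f : L ≤ f
  L≤f = ≤-pred (≤-trans (⌊log₂n⌋<n (≤-trans (s≤s z≤n) (≰⇒> m≰1))) m≤f)
  by-size : Dec (12 ≤ L) → iterate cvRange m (suc (logStarAux f L) * 2 + 3) ≤ 8
  by-size (yes 12≤L) = ≤-trans (iterate-mono cvRange cvRange-mono (logStarAux f L * 2 + 3) cvRange²≤L)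
                               (iterate-cvRange-log* f L L≤f)
    where
    cvRange²≤L : cvRange (cvRange m) ≤ L
    cvRange²≤L = ≤-trans (cvRange²≤ m ⌊ L /2⌋ (⌊n/2⌋-mono 12≤L) (n≤1+⌊n/2⌋*2 L)) (⌊n/2⌋*2≤n L)
  by-size (no L≱12)  = iterate-cvRange-small (<-≤-trans (n<2^suc⌊log₂n⌋ m) (^-monoʳ-≤ 2 (≰⇒> L≱12)))
                                             (suc (logStarAux f L) * 2 + 3) (m≤n+m 3 (suc (logStarAux f L) * 2))

digits-injective : ∀ k .{{_ : NonZero k}} {x y} c c' → x < k → y < k → x + c * k ≡ y + c' * k → x ≡ y × c ≡ c'
digits-injective k {x} {y} c c' x<k y<k eq =
  x≡y , *-cancelʳ-≡ c c' k (+-cancelˡ-≡ x _ _ (trans eq (cong (_+ c' * k) (sym x≡y))))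
  where
  open ≡-Reasoning
  x≡y : x ≡ y
  x≡y = begin
    x                ≡⟨ m<n⇒m%n≡m x<k ⟨
    x % k            ≡⟨ [m+kn]%n≡m%n x c k ⟨
    (x + c * k) % k  ≡⟨ cong (_% k) eq ⟩
    (y + c' * k) % k ≡⟨ [m+kn]%n≡m%n y c' k ⟩
    y % k            ≡⟨ m<n⇒m%n≡m y<k ⟩
    y                ∎

bit : ℕ → ℕ → ℕ
bit zero    a = a % 2
bit (suc i) a = bit i (a / 2)

bit<2 : ∀ i a → bit i a < 2
bit<2 zero    a = m%n<n a 2
bit<2 (suc i) a = bit<2 i (a / 2)

firstDiffWithin : ℕ → ℕ → ℕ → ℕ
firstDiffWithin zero    a b = 0
firstDiffWithin (suc f) a b with a % 2 ≟ b % 2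
... | yes _ = suc (firstDiffWithin f (a / 2) (b / 2))
... | no  _ = 0

-- a + b halvings reach 0, so the fuel a + b always suffices
firstDiff : ℕ → ℕ → ℕ
firstDiff a b = firstDiffWithin (a + b) a b

/2-≢ : ∀ {a b} → a % 2 ≡ b % 2 → a ≢ b → a / 2 ≢ b / 2
/2-≢ {a} {b} %≡ a≢b /≡ = a≢b (begin
  a                 ≡⟨ m≡m%n+[m/n]*n a 2 ⟩
  a % 2 + a / 2 * 2 ≡⟨ cong₂ (λ r q → r + q * 2) %≡ /≡ ⟩
  b % 2 + b / 2 * 2 ≡⟨ m≡m%n+[m/n]*n b 2 ⟨
  b                 ∎)
  where open ≡-Reasoning

/2+/2<+ : ∀ a b → 0 < a + b → a / 2 + b / 2 < a + b
/2+/2<+ zero    (suc b) _ = m/n<m (suc b) 2 (s≤s (s≤s z≤n))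
/2+/2<+ (suc a) b       _ = +-mono-<-≤ (m/n<m (suc a) 2 (s≤s (s≤s z≤n))) (m/n≤m b 2)

≢⇒0<+ : ∀ {a b} → a ≢ b → 0 < a + b
≢⇒0<+ {zero}  {zero}  a≢b = contradiction refl a≢b
≢⇒0<+ {zero}  {suc b} _   = s≤s z≤n
≢⇒0<+ {suc a}         _   = s≤s z≤n

firstDiffWithin-bits : ∀ f {a b} → a ≢ b → a + b ≤ f →
                       bit (firstDiffWithin f a b) a ≢ bit (firstDiffWithin f a b) b
firstDiffWithin-bits zero    a≢b a+b≤0 = contradiction (<-≤-trans (≢⇒0<+ a≢b) a+b≤0) (λ ())
firstDiffWithin-bits (suc f) {a} {b} a≢b a+b≤f with a % 2 ≟ b % 2
... | yes %≡ = firstDiffWithin-bits f (/2-≢ %≡ a≢b) (≤-pred (<-≤-trans (/2+/2<+ a b (≢⇒0<+ a≢b)) a+b≤f))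
... | no  %≢ = %≢

firstDiffWithin< : ∀ L f {a b} → a ≢ b → a < 2 ^ L → b < 2 ^ L → firstDiffWithin f a b < L
firstDiffWithin< zero    f {zero}  {zero}  a≢b _       _       = contradiction refl a≢b
firstDiffWithin< zero    f {zero}  {suc b} _   _       (s≤s ())
firstDiffWithin< zero    f {suc a}         _   (s≤s ()) _
firstDiffWithin< (suc L) zero    _   _ _ = s≤s z≤n
firstDiffWithin< (suc L) (suc f) {a} {b} a≢b a< b< with a % 2 ≟ b % 2
... | yes %≡ = s≤s (firstDiffWithin< L f (/2-≢ %≡ a≢b) (halve a<) (halve b<))
  where
  halve : ∀ {x} → x < 2 ^ suc L → x / 2 < 2 ^ L
  halve {x} x< = m<n*o⇒m/o<n (subst (x <_) (*-comm 2 (2 ^ L)) x<)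
... | no  _  = s≤s z≤n

cvColour : ℕ → ℕ → ℕ
cvColour i a = bit i a + i * 2

cvColour< : ∀ {i} L a → i < L → cvColour i a < L * 2
cvColour< {i} L a i<L = <-≤-trans (+-monoˡ-< (i * 2) (bit<2 i a)) (*-monoˡ-≤ 2 i<L)

-- the new colour records where the lowest bit of a differing from the parent's colour is, and a's bit there
cvNext : ℕ → Maybe ℕ → ℕ
cvNext a p = cvColour (maybe′ (firstDiff a) 0 p) a

cvNext-proper : ∀ {a b} → a ≢ b → ∀ q → cvNext a (just b) ≢ cvNext b q
cvNext-proper {a} {b} a≢b q eq
  with digits-injective 2 (firstDiff a b) i (bit<2 (firstDiff a b) a) (bit<2 i b) eq
  where i = maybe′ (firstDiff b) 0 q
... | bits≡ , index≡ =
  firstDiffWithin-bits (a + b) a≢b ≤-refl (trans bits≡ (cong (λ i → bit i b) (sym index≡)))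

cvNext-root< : ∀ a m → cvNext a nothing < cvRange m
cvNext-root< a m = cvColour< (suc ⌊log₂ m ⌋) a (s≤s z≤n)

cvNext-just< : ∀ {a b m} → a ≢ b → a < m → b < m → cvNext a (just b) < cvRange m
cvNext-just< {a} {b} {m} a≢b a<m b<m =
  cvColour< (suc ⌊log₂ m ⌋) a (firstDiffWithin< (suc ⌊log₂ m ⌋) (a + b) a≢b (<-≤-trans a<m m≤) (<-≤-trans b<m m≤))
  where m≤ = <⇒≤ (n<2^suc⌊log₂n⌋ m)

-- Cole–Vishkin on the port forests

parentVia : Fin n → Maybe (Fin n × ℕ) → Maybe (Fin n)
parentVia v nothing        = nothing
parentVia v (just (w , _)) with toℕ v <? toℕ w
... | yes _ = just w
... | no  _ = nothing

parent : Graph n → ℕ → Fin n → Maybe (Fin n)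
parent G j v = parentVia v (probeG G v (suc j))

cv : Graph n → ℕ → ℕ → Fin n → ℕ
cv G j zero    v = toℕ v
cv G j (suc t) v = cvNext (cv G j t v) (Maybe.map (cv G j t) (parent G j v))

module _ (G : Graph n) where

  parent-< : ∀ j v {w} → parent G j v ≡ just w → toℕ v < toℕ w
  parent-< j v {w} eq with probeG G v (suc j)
  ... | just (u , _) with toℕ v <? toℕ u
  parent-< j v refl | just (u , _) | yes v<u = v<u

  parent-port : ∀ v (i : Fin (deg G v)) → toℕ v < toℕ (nbr G v i) → parent G (toℕ i) v ≡ just (nbr G v i)
  parent-port v i v<w rewrite probeG-port G v i with toℕ v <? toℕ (nbr G v i)
  ... | yes _   = refl
  ... | no  v≮w = contradiction v<w v≮w

  parent-edge : ∀ v (i : Fin (deg G v)) → toℕ (nbr G v i) < toℕ v →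
                parent G (toℕ (back G v i)) (nbr G v i) ≡ just v
  parent-edge v i w<v =
    trans (parent-port (nbr G v i) (back G v i) (subst (λ u → toℕ (nbr G v i) < toℕ u) (sym (nbr-back G v i)) w<v))
          (cong just (nbr-back G v i))

  cv-range : ∀ j t v → cv G j t v < iterate cvRange n t
  cv-proper : ∀ j t v {w} → parent G j v ≡ just w → cv G j t v ≢ cv G j t w

  cv-range j zero    v = toℕ<n v
  cv-range j (suc t) v rewrite iterate-suc cvRange n t = go (parent G j v) refl
    where
    go : ∀ p → parent G j v ≡ p → cvNext (cv G j t v) (Maybe.map (cv G j t) p) < cvRange (iterate cvRange n t)
    go nothing  _  = cvNext-root< (cv G j t v) (iterate cvRange n t)
    go (just w) eq = cvNext-just< (cv-proper j t v eq) (cv-range j t v) (cv-range j t w)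

  cv-proper j zero    v eq = <⇒≢ (parent-< j v eq)
  cv-proper j (suc t) v {w} eq rewrite eq = cvNext-proper (cv-proper j t v eq) (Maybe.map (cv G j t) (parent G j w))

ancestorsP    : ℕ → ℕ → Fin n → Probing n (List ℕ)
ancestorsFrom : ℕ → ℕ → Maybe (Fin n) → Probing n (List ℕ)
ancestorsP    j zero    v        = answer []
ancestorsP    j (suc f) v        = probe v (suc j) (ancestorsFrom j f ∘ parentVia v)
ancestorsFrom j f       nothing  = answer []
ancestorsFrom j f       (just w) = (toℕ w ∷_) <$> ancestorsP j f w

-- the Cole–Vishkin colour after t rounds of the first vertex of a chain, each entry's parent being the next one
cvChain : ℕ → ℕ → List ℕ → ℕ
cvChain zero    x _        = x
cvChain (suc t) x []       = cvNext (cvChain t x []) nothing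
cvChain (suc t) x (y ∷ ys) = cvNext (cvChain t x (y ∷ ys)) (just (cvChain t y ys))

cvP : ℕ → ℕ → Fin n → Probing n ℕ
cvP j t v = cvChain t (toℕ v) <$> ancestorsP j t v

module _ (G : Graph n) (j : ℕ) where

  cvChain-ancestors : ∀ t f v → t ≤ f → cvChain t (toℕ v) (run G (ancestorsP j f v)) ≡ cv G j t v
  cvChain-ancestors zero    f       v _         = refl
  cvChain-ancestors (suc t) (suc f) v (s≤s t≤f) =
    go (parent G j v) (cvChain-ancestors t (suc f) v (m≤n⇒m≤1+n t≤f))
    where
    go : ∀ p → cvChain t (toℕ v) (run G (ancestorsFrom j f p)) ≡ cv G j t v →
         cvChain (suc t) (toℕ v) (run G (ancestorsFrom j f p)) ≡ cvNext (cv G j t v) (Maybe.map (cv G j t) p)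
    go nothing  ih = cong (λ c → cvNext c nothing) ih
    go (just w) ih = begin
      cvChain (suc t) (toℕ v) (run G (ancestorsFrom j f (just w))) ≡⟨ cong (cvChain (suc t) (toℕ v)) run≡ ⟩
      cvChain (suc t) (toℕ v) (toℕ w ∷ ancestors)                   ≡⟨ cong₂ (λ a b → cvNext a (just b))
                                                                           (trans (cong (cvChain t (toℕ v)) (sym run≡)) ih)
                                                                           (cvChain-ancestors t f w t≤f) ⟩
      cvNext (cv G j t v) (just (cv G j t w))                        ∎
      where
      open ≡-Reasoning
      ancestors = run G (ancestorsP j f w)
      run≡ : run G (ancestorsFrom j f (just w)) ≡ toℕ w ∷ ancestors
      run≡ = run-<$> G (toℕ w ∷_) (ancestorsP j f w)

  probes-ancestorsP : ∀ f v → probes G (ancestorsP j f v) ≤ f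
  probes-ancestorsP zero    v = z≤n
  probes-ancestorsP (suc f) v = s≤s (go (parent G j v))
    where
    go : ∀ p → probes G (ancestorsFrom j f p) ≤ f
    go nothing  = z≤n
    go (just w) = subst (_≤ f) (sym (probes-<$> G (toℕ w ∷_) (ancestorsP j f w))) (probes-ancestorsP f w)

  run-cvP : ∀ t v → run G (cvP j t v) ≡ cv G j t v
  run-cvP t v = trans (run-<$> G _ (ancestorsP j t v)) (cvChain-ancestors t t v ≤-refl)

  probes-cvP : ∀ t v → probes G (cvP j t v) ≤ t
  probes-cvP t v = subst (_≤ t) (sym (probes-<$> G _ (ancestorsP j t v))) (probes-ancestorsP t v)

cvRounds : ℕ → ℕ
cvRounds n = log* n * 2 + 3

cv-<8 : ∀ (G : Graph n) j v → cv G j (cvRounds n) v < 8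
cv-<8 {n} G j v = <-≤-trans (cv-range G j (cvRounds n) v) (iterate-cvRange-log* n n ≤-refl)

-- (Δ + 1)-colouring

Occurs : ∀ {Δ} → Vec (Maybe ℕ) Δ → ℕ → Set
Occurs cs y = ∃ λ j → lookup cs j ≡ just y

module _ {Δ} (cs : Vec (Maybe ℕ) Δ) where

  occurs? : ∀ y → Dec (Occurs cs y)
  occurs? y = any? λ j → Maybe.≡-dec _≟_ (lookup cs j) (just y)

  not-all-occur : ¬ (∀ (y : Fin (suc Δ)) → Occurs cs (toℕ y))
  not-all-occur occurrence with pigeonhole (n<1+n Δ) (proj₁ ∘ occurrence)
  ... | y , y' , y<y' , same = <⇒≢ y<y' (Maybe.just-injective (begin
    just (toℕ y)                      ≡⟨ sym (proj₂ (occurrence y)) ⟩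
    lookup cs (proj₁ (occurrence y))  ≡⟨ cong (lookup cs) same ⟩
    lookup cs (proj₁ (occurrence y')) ≡⟨ proj₂ (occurrence y') ⟩
    just (toℕ y')                     ∎))
    where open ≡-Reasoning

  freeColourExists : ∃ λ (y : Fin (suc Δ)) → ¬ Occurs cs (toℕ y)
  freeColourExists with any? (λ y → ¬? (occurs? (toℕ y)))
  ... | yes free = free
  ... | no  none = contradiction (λ y → decidable-stable (occurs? (toℕ y)) (λ ¬occ → none (y , ¬occ))) not-all-occur

  freeColour : ℕ
  freeColour = toℕ (proj₁ freeColourExists)

  freeColour≤ : freeColour ≤ Δ
  freeColour≤ = ≤-pred (toℕ<n (proj₁ freeColourExists))

  freeColour-fresh : ∀ j → lookup cs j ≢ just freeColour
  freeColour-fresh j eq = proj₂ freeColourExists (j , eq)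

module Colouring (Δ : ℕ) where

  record ColState : Set where
    constructor ⟨_,_⟩
    field
      cvColours : Vec ℕ Δ
      colour    : ℕ
  open ColState public

  reductionRounds : ℕ
  reductionRounds = suc Δ * 7

  -- a stage starts with colours below suc Δ * 8 and each of its rounds removes the largest one
  palette : ℕ
  palette = suc Δ + reductionRounds

  recolour : ∀ {c x : ℕ} → Dec (c ≡ x) → ℕ → ℕ
  recolour     (yes _) f = f
  recolour {c} (no  _) f = c

  colourSeen : Maybe (ColState × ℕ) → Maybe ℕ
  colourSeen = Maybe.map (colour ∘ proj₁)

  reduce : Round ColState Δ
  reduce r s vs = ⟨ cvColours s , recolour (colour s ≟ palette ∸ suc r) (freeColour (Vec.map colourSeen vs)) ⟩

  stageStart : ℕ → ColState → ColState
  stageStart k s = ⟨ cvColours s , at 0 (cvColours s) k + colour s * 8 ⟩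

  cvVector : Graph n → Fin n → Vec ℕ Δ
  cvVector {n} G v = tabulate (λ j → cv G (toℕ j) (cvRounds n) v)

  colouring : Graph n → ℕ → Fin n → ColState
  colouring G zero    v = ⟨ cvVector G v , 0 ⟩
  colouring G (suc k) v = rounds G reduce (stageStart k ∘ colouring G k) reductionRounds v

  colouringP : ℕ → Fin n → Probing n ColState
  colouringP {n} zero v = (λ ψ → ⟨ ψ , 0 ⟩) <$> sequenceP Δ (λ j → cvP j (cvRounds n) v)
  colouringP (suc k) v = roundsP reduce (λ w → stageStart k <$> colouringP k w) reductionRounds v

  module _ (G : Graph n) where

    run-colouringP : ∀ k v → run G (colouringP k v) ≡ colouring G k v
    run-colouringP zero v =
      trans (run-<$> G _ (sequenceP Δ (λ j → cvP j (cvRounds n) v)))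
            (cong (λ ψ → ⟨ ψ , 0 ⟩) (run-sequenceP G Δ _ _ (λ j → run-cvP G j (cvRounds n) v)))
    run-colouringP (suc k) v =
      run-roundsP G reduce (λ w → trans (run-<$> G (stageStart k) (colouringP k w)) (cong (stageStart k) (run-colouringP k w)))
                  reductionRounds v

    probes-colouringP : ∀ k v → suc (probes G (colouringP k v)) ≤ suc Δ ^ (reductionRounds * k) * suc (Δ * cvRounds n)
    probes-colouringP zero v
      rewrite probes-<$> G (λ ψ → ⟨ ψ , 0 ⟩) (sequenceP Δ (λ j → cvP j (cvRounds n) v))
            | *-zeroʳ reductionRounds | *-identityˡ (suc (Δ * cvRounds n))
      = s≤s (probes-sequenceP G Δ (λ j → cvP j (cvRounds n) v) (λ j → probes-cvP G j (cvRounds n) v))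
    probes-colouringP (suc k) v = subst (suc (probes G (colouringP (suc k) v)) ≤_) exponents
      (probes-roundsP G reduce
        (λ w → subst (λ p → suc p ≤ _) (sym (probes-<$> G (stageStart k) (colouringP k w))) (probes-colouringP k w))
        reductionRounds v)
      where
      Q = suc (Δ * cvRounds n)
      R = reductionRounds
      exponents : suc Δ ^ R * (suc Δ ^ (R * k) * Q) ≡ suc Δ ^ (R * suc k) * Q
      exponents = begin
        suc Δ ^ R * (suc Δ ^ (R * k) * Q) ≡⟨ *-assoc (suc Δ ^ R) (suc Δ ^ (R * k)) Q ⟨
        suc Δ ^ R * suc Δ ^ (R * k) * Q   ≡⟨ cong (_* Q) (^-distribˡ-+-* (suc Δ) R (R * k)) ⟨
        suc Δ ^ (R + R * k) * Q           ≡⟨ cong (λ e → suc Δ ^ e * Q) (*-suc R k) ⟨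
        suc Δ ^ (R * suc k) * Q           ∎
        where open ≡-Reasoning

  module _ (G : Graph n) (Δ≥deg : ∀ v → deg G v ≤ Δ) where

    forest : ∀ v → Fin (deg G v) → ℕ
    forest v i with toℕ v <? toℕ (nbr G v i)
    ... | yes _ = toℕ i
    ... | no  _ = toℕ (back G v i)

    forest<Δ : ∀ v i → forest v i < Δ
    forest<Δ v i with toℕ v <? toℕ (nbr G v i)
    ... | yes _ = <-≤-trans (toℕ<n i) (Δ≥deg v)
    ... | no  _ = <-≤-trans (toℕ<n (back G v i)) (Δ≥deg (nbr G v i))

    cv-separates : ∀ v i → cv G (forest v i) (cvRounds n) v ≢ cv G (forest v i) (cvRounds n) (nbr G v i)
    cv-separates v i with toℕ v <? toℕ (nbr G v i)
    ... | yes v<w = cv-proper G (toℕ i) (cvRounds n) v (parent-port G v i v<w)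
    ... | no  v≮w = cv-proper G (toℕ (back G v i)) (cvRounds n) (nbr G v i) (parent-edge G v i w<v) ∘ sym
      where w<v = ≤∧≢⇒< (≮⇒≥ v≮w) (λ eq → loopless G v i (toℕ-injective eq))

    cvVector-at : ∀ v {k} → k < Δ → at 0 (cvVector G v) k ≡ cv G k (cvRounds n) v
    cvVector-at v = at-tabulate 0 (λ j → cv G j (cvRounds n) v)

    cvVector-at<8 : ∀ v k → at 0 (cvVector G v) k < 8
    cvVector-at<8 v = at-∀ {P = _< 8} (cvVector G v) (s≤s z≤n)
                           (λ j → subst (_< 8) (sym (lookup∘tabulate _ j)) (cv-<8 G (toℕ j) v))

    record Invariant (k b : ℕ) (st : Fin n → ColState) : Set where
      field
        cvColours≡ : ∀ v → cvColours (st v) ≡ cvVector G v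
        colour<    : ∀ v → colour (st v) < b
        proper     : ∀ v i → forest v i < k → colour (st v) ≢ colour (st (nbr G v i))
    open Invariant

    module _ {k st} (inv : Invariant k (suc Δ) st) where

      stage-cv<8 : ∀ u → at 0 (cvColours (st u)) k < 8
      stage-cv<8 u = subst (λ ψ → at 0 ψ k < 8) (sym (cvColours≡ inv u)) (cvVector-at<8 u k)

      stage-cv≢ : ∀ v i → forest v i ≡ k → at 0 (cvColours (st v)) k ≢ at 0 (cvColours (st (nbr G v i))) k
      stage-cv≢ v i refl eq = cv-separates v i (begin
        cv G (forest v i) (cvRounds n) v      ≡⟨ cvVector-at v (forest<Δ v i) ⟨
        at 0 (cvVector G v) (forest v i)      ≡⟨ cong (λ ψ → at 0 ψ (forest v i)) (cvColours≡ inv v) ⟨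
        at 0 (cvColours (st v)) (forest v i)  ≡⟨ eq ⟩
        at 0 (cvColours (st w)) (forest v i)  ≡⟨ cong (λ ψ → at 0 ψ (forest v i)) (cvColours≡ inv w) ⟩
        at 0 (cvVector G w) (forest v i)      ≡⟨ cvVector-at w (forest<Δ v i) ⟩
        cv G (forest v i) (cvRounds n) w      ∎)
        where
        open ≡-Reasoning
        w = nbr G v i

      stageStart-invariant : Invariant (suc k) palette (stageStart k ∘ st)
      cvColours≡ stageStart-invariant = cvColours≡ inv
      colour<    stageStart-invariant v = begin-strict
        at 0 (cvColours (st v)) k + colour (st v) * 8 <⟨ +-monoˡ-< _ (stage-cv<8 v) ⟩
        suc (colour (st v)) * 8                       ≤⟨ *-monoˡ-≤ 8 (colour< inv v) ⟩
        suc Δ * 8                                     ≡⟨ *-suc (suc Δ) 7 ⟩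
        palette                                       ∎
        where open ≤-Reasoning
      proper     stageStart-invariant v i forest≤k eq =
        [ (λ forest<k → proper inv v i forest<k colour≡) , (λ forest≡k → stage-cv≢ v i forest≡k cv≡) ]′
          (m≤n⇒m<n∨m≡n (≤-pred forest≤k))
        where
        digits = digits-injective 8 (colour (st v)) (colour (st (nbr G v i))) (stage-cv<8 v) (stage-cv<8 (nbr G v i)) eq
        cv≡ = proj₁ digits
        colour≡ = proj₂ digits

    freeColour-avoids : ∀ st v (i : Fin (deg G v)) →
                        freeColour (Vec.map colourSeen (viewG G Δ st v)) ≢ colour (st (nbr G v i))
    freeColour-avoids st v i eq = freeColour-fresh colours j (begin
      lookup colours j                       ≡⟨ lookup-map j colourSeen (viewG G Δ st v) ⟩
      colourSeen (lookup (viewG G Δ st v) j) ≡⟨ cong colourSeen (lookup-view-port G Δ≥deg v i) ⟩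
      just (colour (st (nbr G v i)))         ≡⟨ cong just eq ⟨
      just (freeColour colours)              ∎)
      where
      open ≡-Reasoning
      colours = Vec.map colourSeen (viewG G Δ st v)
      j = inject≤ i (Δ≥deg v)

    reduce-invariant : ∀ {k r st} → r < reductionRounds → Invariant k (palette ∸ r) st →
                       Invariant k (palette ∸ suc r) (λ v → reduce r (st v) (viewG G Δ st v))
    cvColours≡ (reduce-invariant r<R inv) = cvColours≡ inv
    colour<    (reduce-invariant {r = r} {st} r<R inv) v with colour (st v) ≟ palette ∸ suc r
    ... | yes _ = <-≤-trans (s≤s (freeColour≤ _)) (begin
      suc Δ                         ≤⟨ m≤m+n (suc Δ) _ ⟩
      suc Δ + (reductionRounds ∸ suc r) ≡⟨ +-∸-assoc (suc Δ) r<R ⟨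
      palette ∸ suc r               ∎)
      where open ≤-Reasoning
    ... | no  c≢x = ≤∧≢⇒< (subst (colour (st v) ≤_) (pred[m∸n]≡m∸[1+n] palette r) (pred-mono-≤ (colour< inv v))) c≢x
    proper     (reduce-invariant {r = r} {st} r<R inv) v i forest<k
      with colour (st v) ≟ palette ∸ suc r | colour (st (nbr G v i)) ≟ palette ∸ suc r
    ... | yes v≡x | yes w≡x = contradiction (trans v≡x (sym w≡x)) (proper inv v i forest<k)
    ... | yes _   | no  _   = freeColour-avoids st v i
    ... | no  _   | yes _   = λ eq → freeColour-avoids st (nbr G v i) (back G v i)
                                      (trans (sym eq) (cong (λ u → colour (st u)) (sym (nbr-back G v i))))
    ... | no  _   | no  _   = proper inv v i forest<k

    rounds-invariant : ∀ {k s₀} → Invariant k palette s₀ →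
                       ∀ r → r ≤ reductionRounds → Invariant k (palette ∸ r) (rounds G reduce s₀ r)
    rounds-invariant inv zero    _   = inv
    rounds-invariant inv (suc r) r<R = reduce-invariant r<R (rounds-invariant inv r (<⇒≤ r<R))

    initial-invariant : Invariant 0 (suc Δ) (colouring G 0)
    cvColours≡ initial-invariant v     = refl
    colour<    initial-invariant v     = s≤s z≤n
    proper     initial-invariant v i ()

    colouring-invariant : ∀ k → Invariant k (suc Δ) (colouring G k)
    colouring-invariant zero    = initial-invariant
    colouring-invariant (suc k) = subst (λ b → Invariant (suc k) b (colouring G (suc k))) (m+n∸n≡m (suc Δ) reductionRounds)
      (rounds-invariant {s₀ = stageStart k ∘ colouring G k} (stageStart-invariant (colouring-invariant k)) reductionRounds ≤-refl)

    colouring-proper : ∀ v i → colour (colouring G Δ v) ≢ colour (colouring G Δ (nbr G v i))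
    colouring-proper v i = proper (colouring-invariant Δ) v i (forest<Δ v i)

    colouring-< : ∀ v → colour (colouring G Δ v) < suc Δ
    colouring-< = colour< (colouring-invariant Δ)

-- Maximal independent set

module MaximalIndependentSet (Δ : ℕ) where
  open Colouring Δ using (ColState; colouring; colouringP; run-colouringP; probes-colouringP;
                         colouring-proper; colouring-<; reductionRounds)

  record MISState : Set where
    constructor ⟨_,_⟩
    field
      colour : ℕ
      inSet  : Bool
  open MISState public

  inSetSeen : Maybe (MISState × ℕ) → Bool
  inSetSeen = maybe′ (inSet ∘ proj₁) false

  Dominated : View MISState Δ → Set
  Dominated vs = ∃ λ j → inSetSeen (lookup vs j) ≡ true

  dominated? : (vs : View MISState Δ) → Dec (Dominated vs)
  dominated? vs = any? λ j → inSetSeen (lookup vs j) Bool.≟ true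

  membership : ∀ {P D : Set} → Dec P → Dec D → Bool → Bool
  membership (no  _) _       b = b
  membership (yes _) (yes _) _ = false
  membership (yes _) (no  _) _ = true

  joinRound : Round MISState Δ
  joinRound r s vs = ⟨ colour s , membership (colour s ≟ r) (dominated? vs) (inSet s) ⟩

  fromColouring : ColState → MISState
  fromColouring s = ⟨ Colouring.colour s , false ⟩

  mis : Graph n → ℕ → Fin n → MISState
  mis G = rounds G joinRound (fromColouring ∘ colouring G Δ)

  misP : ℕ → Fin n → Probing n MISState
  misP = roundsP joinRound (λ w → fromColouring <$> colouringP Δ w)

  module _ (G : Graph n) where

    run-misP : ∀ r v → run G (misP r v) ≡ mis G r v
    run-misP = run-roundsP G joinRound
      (λ w → trans (run-<$> G fromColouring (colouringP Δ w)) (cong fromColouring (run-colouringP G Δ w)))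

    probes-misP : ∀ r v → suc (probes G (misP r v)) ≤ suc Δ ^ r * (suc Δ ^ (reductionRounds * Δ) * suc (Δ * cvRounds n))
    probes-misP = probes-roundsP G joinRound
      (λ w → subst (λ p → suc p ≤ _) (sym (probes-<$> G fromColouring (colouringP Δ w))) (probes-colouringP G Δ w))

  module _ (G : Graph n) (Δ≥deg : ∀ v → deg G v ≤ Δ) where

    finalColour : Fin n → ℕ
    finalColour v = Colouring.colour (colouring G Δ v)

    record Invariant (r : ℕ) : Set where
      field
        colour≡     : ∀ v → colour (mis G r v) ≡ finalColour v
        joined<     : ∀ v → inSet (mis G r v) ≡ true → finalColour v < r
        independent : ∀ v i → inSet (mis G r v) ≡ true → inSet (mis G r (nbr G v i)) ≢ true
        dominating  : ∀ v → finalColour v < r → inSet (mis G r v) ≡ false →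
                      ∃ λ i → inSet (mis G r (nbr G v i)) ≡ true
    open Invariant

    module _ {r} (inv : Invariant r) where

      joined-stays : ∀ v → inSet (mis G r v) ≡ true → inSet (mis G (suc r) v) ≡ true
      joined-stays v joined with colour (mis G r v) ≟ r
      ... | yes c≡r = contradiction (trans (sym (colour≡ inv v)) c≡r) (<⇒≢ (joined< inv v joined))
      ... | no  _   = joined

      neighbour⇒dominated : ∀ v i → inSet (mis G r (nbr G v i)) ≡ true → Dominated (viewG G Δ (mis G r) v)
      neighbour⇒dominated v i joined = inject≤ i (Δ≥deg v) , trans (cong inSetSeen (lookup-view-port G Δ≥deg v i)) joined

      dominated⇒neighbour : ∀ v → Dominated (viewG G Δ (mis G r) v) → ∃ λ i → inSet (mis G r (nbr G v i)) ≡ true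
      dominated⇒neighbour v (j , joined) with lookup (viewG G Δ (mis G r) v) j in seen≡
      ... | just (s , b) with lookup-view-just G (mis G r) v j seen≡
      ...   | i , _ , refl , _ = i , joined

      joinRound-invariant : Invariant (suc r)
      colour≡     joinRound-invariant = colour≡ inv
      joined<     joinRound-invariant v joined with colour (mis G r v) ≟ r
      ... | yes c≡r = ≤-reflexive (cong suc (trans (sym (colour≡ inv v)) c≡r))
      ... | no  _   = m≤n⇒m≤1+n (joined< inv v joined)
      independent joinRound-invariant v i with colour (mis G r v) ≟ r | colour (mis G r (nbr G v i)) ≟ r
                                           | dominated? (viewG G Δ (mis G r) v)
                                           | dominated? (viewG G Δ (mis G r) (nbr G v i))
      ... | yes v≡r | yes w≡r | _ | _ = λ _ _ → colouring-proper G Δ≥deg v i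
                                                   (trans (sym (colour≡ inv v)) (trans v≡r (trans (sym w≡r) (colour≡ inv (nbr G v i)))))
      ... | yes _ | no  _ | yes _  | _ = λ ()
      ... | yes _ | no  _ | no  ¬d | _ = λ _ w-joined → ¬d (neighbour⇒dominated v i w-joined)
      ... | no  _ | yes _ | _ | yes _  = λ _ ()
      ... | no  _ | yes _ | _ | no  ¬d = λ v-joined _ → ¬d (neighbour⇒dominated (nbr G v i) (back G v i)
                                                        (subst (λ u → inSet (mis G r u) ≡ true) (sym (nbr-back G v i)) v-joined))
      ... | no  _ | no  _ | _ | _ = independent inv v i
      dominating  joinRound-invariant v c≤r out with colour (mis G r v) ≟ r | dominated? (viewG G Δ (mis G r) v)
      ... | yes _ | yes d = let i , joined = dominated⇒neighbour v d in i , joined-stays (nbr G v i) joined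
      ... | no  c≢r | _ with dominating inv v (≤∧≢⇒< (≤-pred c≤r) (c≢r ∘ trans (colour≡ inv v))) out
      ...   | i , joined = i , joined-stays (nbr G v i) joined

    initial-invariant : Invariant 0
    colour≡     initial-invariant v = refl
    joined<     initial-invariant v ()
    independent initial-invariant v i ()
    dominating  initial-invariant v ()

    mis-invariant : ∀ r → Invariant r
    mis-invariant zero    = initial-invariant
    mis-invariant (suc r) = joinRound-invariant (mis-invariant r)

    mis-isMIS : IsMIS G (inSet ∘ mis G (suc Δ))
    proj₁ mis-isMIS v i joined = Bool.¬-not (independent (mis-invariant (suc Δ)) v i joined)
    proj₂ mis-isMIS v = dominating (mis-invariant (suc Δ)) v (colouring-< G Δ≥deg v)

-- Maximal matching

just≢nothing : ∀ {A : Set} {a : A} → just a ≢ nothing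
just≢nothing ()

acceptance : ∀ {k} {P : Set} {Q : Fin k → Set} → Dec P → Dec (∃ Q) → Maybe ℕ
acceptance (yes _) (yes (q , _)) = just (toℕ q)
acceptance _       _             = nothing

acceptance-just : ∀ {k} {P : Set} {Q : Fin k → Set} (d : Dec P) (e : Dec (∃ Q)) {p} →
                  acceptance d e ≡ just p → P × ∃ λ q → toℕ q ≡ p × Q q
acceptance-just (yes a) (yes (q , b)) refl = a , q , refl , b

acceptance-yes : ∀ {k} {P : Set} {Q : Fin k → Set} (d : Dec P) (e : Dec (∃ Q)) → P → ∃ Q → acceptance d e ≢ nothing
acceptance-yes (yes _) (yes _) _ _  ()
acceptance-yes (no ¬a) _       a _  = contradiction a ¬a
acceptance-yes (yes _) (no ¬b) _ b  = contradiction b ¬b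

settle : ∀ {P : Set} → ℕ → Maybe ℕ → Dec P → Maybe ℕ → Maybe ℕ
settle j (just q) _       m = just q
settle j nothing  (yes _) m = just j
settle j nothing  (no  _) m = m

settle-cases : ∀ {P : Set} j a (d : Dec P) m {q} → settle j a d m ≡ just q →
               a ≡ just q ⊎ (q ≡ j × P) ⊎ m ≡ just q
settle-cases j (just _) d       m refl = inj₁ refl
settle-cases j nothing  (yes p) m refl = inj₂ (inj₁ (refl , p))
settle-cases j nothing  (no  _) m eq   = inj₂ (inj₂ eq)

settle-keeps : ∀ {P : Set} j (d : Dec P) m → ¬ P → settle j nothing d m ≡ m
settle-keeps j (yes p) m ¬p = contradiction p ¬p
settle-keeps j (no  _) m _  = refl

settle-proposed : ∀ {P : Set} j (d : Dec P) m → P → settle j nothing d m ≡ just j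
settle-proposed j (yes _) m _ = refl
settle-proposed j (no ¬p) m p = contradiction p ¬p

leadsTo : Fin n → Fin n → Maybe ℕ → Probing n Bool
leadsTo u v nothing  = answer false
leadsTo u v (just p) = probe u (suc p) (answer ∘ maybe′ (λ (w , _) → does (w Fin.≟ v)) false)

module _ (G : Graph n) where

  leadsTo-true : ∀ u v m → run G (leadsTo u v m) ≡ true → Σ (Fin (deg G u)) λ i → m ≡ just (toℕ i) × nbr G u i ≡ v
  leadsTo-true u v (just p) eq with probeG G u (suc p) in probe≡
  ... | just (w , b) with probeG-just G u p probe≡ | w Fin.≟ v
  ...   | i , i≡p , refl , refl | yes w≡v = i , cong just (sym i≡p) , w≡v
  leadsTo-true u v (just p) () | just (w , b) | _ | no _
  leadsTo-true u v (just p) () | nothing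
  leadsTo-true u v nothing  ()

  leadsTo-port : ∀ u i → run G (leadsTo u (nbr G u i) (just (toℕ i))) ≡ true
  leadsTo-port u i rewrite probeG-port G u i = dec-true (nbr G u i Fin.≟ nbr G u i) refl

  probes-leadsTo : ∀ u v m → probes G (leadsTo u v m) ≤ 1
  probes-leadsTo u v nothing  = z≤n
  probes-leadsTo u v (just p) = s≤s z≤n

module MaximalMatching (Δ : ℕ) where
  open Colouring Δ using (ColState; colouring; colouringP; run-colouringP; probes-colouringP;
                         colouring-proper; colouring-<; reductionRounds)

  record MatchState : Set where
    constructor ⟨_,_,_⟩
    field
      colour   : ℕ
      mate     : Maybe ℕ
      accepted : Maybe ℕ
  open MatchState public

  Free : ℕ → MatchState → Set
  Free x s = mate s ≡ nothing × colour s ≢ x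

  free? : ∀ x s → Dec (Free x s)
  free? x s = Maybe.≡-dec _≟_ (mate s) nothing ×-dec ¬? (colour s ≟ x)

  Proposes : ℕ → ℕ → Maybe (MatchState × ℕ) → Set
  Proposes x j nothing        = ⊥
  Proposes x j (just (s , b)) = colour s ≡ x × mate s ≡ nothing × b ≡ suc j

  proposes? : ∀ x j e → Dec (Proposes x j e)
  proposes? x j nothing        = no λ ()
  proposes? x j (just (s , b)) = (colour s ≟ x) ×-dec Maybe.≡-dec _≟_ (mate s) nothing ×-dec (b ≟ suc j)

  Accepts : Maybe (MatchState × ℕ) → Set
  Accepts nothing        = ⊥
  Accepts (just (s , b)) = accepted s ≡ just (pred b)

  accepts? : ∀ e → Dec (Accepts e)
  accepts? nothing        = no λ ()
  accepts? (just (s , b)) = Maybe.≡-dec _≟_ (accepted s) (just (pred b))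

  Matches : ℕ → ℕ → MatchState → View MatchState Δ → Set
  Matches x j s vs = (mate s ≡ nothing × colour s ≡ x) × Accepts (at nothing vs j)

  matches? : ∀ x j s vs → Dec (Matches x j s vs)
  matches? x j s vs = (Maybe.≡-dec _≟_ (mate s) nothing ×-dec (colour s ≟ x)) ×-dec accepts? (at nothing vs j)

  -- Phase (x, j): every unmatched vertex of colour x proposes to its neighbour through port j; an unmatched
  -- vertex of another colour accepts one proposal, and in the second round both ends record the match.
  acceptRound : ℕ → ℕ → MatchState → View MatchState Δ → MatchState
  acceptRound x j s vs = ⟨ colour s , mate s , acceptance (free? x s) (any? (proposes? x j ∘ lookup vs)) ⟩

  matchRound : ℕ → ℕ → MatchState → View MatchState Δ → MatchState
  matchRound x j s vs = ⟨ colour s , settle j (accepted s) (matches? x j s vs) (mate s) , nothing ⟩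

  phase : ℕ → ℕ → Round MatchState Δ
  phase x j zero    = acceptRound x j
  phase x j (suc _) = matchRound x j

  fromColouring : ColState → MatchState
  fromColouring s = ⟨ Colouring.colour s , nothing , nothing ⟩

  -- the states after all phases (x', j') preceding (x, j) in lexicographic order
  matching : Graph n → ℕ → ℕ → Fin n → MatchState
  matching G x       (suc j) v = rounds G (phase x j) (matching G x j) 2 v
  matching G zero    zero    v = fromColouring (colouring G Δ v)
  matching G (suc x) zero    v = matching G x Δ v

  matchingP : ℕ → ℕ → Fin n → Probing n MatchState
  matchingP x       (suc j) v = roundsP (phase x j) (matchingP x j) 2 v
  matchingP zero    zero    v = fromColouring <$> colouringP Δ v
  matchingP (suc x) zero    v = matchingP x Δ v

  module _ (G : Graph n) where

    run-matchingP : ∀ x j v → run G (matchingP x j v) ≡ matching G x j v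
    run-matchingP x       (suc j) v = run-roundsP G (phase x j) {s₀P = matchingP x j} (run-matchingP x j) 2 v
    run-matchingP zero    zero    v = trans (run-<$> G fromColouring (colouringP Δ v)) (cong fromColouring (run-colouringP G Δ v))
    run-matchingP (suc x) zero    v = run-matchingP x Δ v

    probes-matchingP : ∀ x j v → suc (probes G (matchingP x j v)) ≤
                       suc Δ ^ (2 * (x * Δ + j)) * (suc Δ ^ (reductionRounds * Δ) * suc (Δ * cvRounds n))
    probes-matchingP zero    zero    v
      rewrite probes-<$> G fromColouring (colouringP Δ v) | +-identityʳ (suc Δ ^ (reductionRounds * Δ) * suc (Δ * cvRounds n))
      = probes-colouringP G Δ v
    probes-matchingP (suc x) zero    v = subst (λ e → suc (probes G (matchingP x Δ v)) ≤
                                                      suc Δ ^ (2 * e) * (suc Δ ^ (reductionRounds * Δ) * suc (Δ * cvRounds n)))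
                                               (trans (+-comm (x * Δ) Δ) (sym (+-identityʳ (Δ + x * Δ))))
                                               (probes-matchingP x Δ v)
    probes-matchingP x       (suc j) v = subst (suc (probes G (matchingP x (suc j) v)) ≤_) exponents
      (probes-roundsP G (phase x j) {s₀P = matchingP x j} (probes-matchingP x j) 2 v)
      where
      open ≡-Reasoning
      Q = suc Δ ^ (reductionRounds * Δ) * suc (Δ * cvRounds n)
      exponents : suc Δ ^ 2 * (suc Δ ^ (2 * (x * Δ + j)) * Q) ≡ suc Δ ^ (2 * (x * Δ + suc j)) * Q
      exponents = begin
        suc Δ ^ 2 * (suc Δ ^ (2 * (x * Δ + j)) * Q) ≡⟨ *-assoc (suc Δ ^ 2) (suc Δ ^ (2 * (x * Δ + j))) Q ⟨
        suc Δ ^ 2 * suc Δ ^ (2 * (x * Δ + j)) * Q   ≡⟨ cong (_* Q) (^-distribˡ-+-* (suc Δ) 2 (2 * (x * Δ + j))) ⟨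
        suc Δ ^ (2 + 2 * (x * Δ + j)) * Q           ≡⟨ cong (λ e → suc Δ ^ e * Q) (*-suc 2 (x * Δ + j)) ⟨
        suc Δ ^ (2 * suc (x * Δ + j)) * Q           ≡⟨ cong (λ e → suc Δ ^ (2 * e) * Q) (+-suc (x * Δ) j) ⟨
        suc Δ ^ (2 * (x * Δ + suc j)) * Q           ∎

  module _ (G : Graph n) (Δ≥deg : ∀ v → deg G v ≤ Δ) where

    finalColour : Fin n → ℕ
    finalColour v = Colouring.colour (colouring G Δ v)

    Covered : (Fin n → MatchState) → ∀ v → Fin (deg G v) → Set
    Covered st v i = mate (st v) ≡ nothing → mate (st (nbr G v i)) ≢ nothing

    record Invariant (x j : ℕ) (st : Fin n → MatchState) : Set where
      field
        colour≡          : ∀ v → colour (st v) ≡ finalColour v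
        mate<deg         : ∀ v {p} → mate (st v) ≡ just p → p < deg G v
        mate-sym         : ∀ v i → mate (st v) ≡ just (toℕ i) → mate (st (nbr G v i)) ≡ just (toℕ (back G v i))
        covered-colours  : ∀ v i → finalColour v < x → Covered st v i
        covered-ports    : ∀ v i → finalColour v ≡ x → toℕ i < j → Covered st v i
    open Invariant

    module Phase {x j} {s₀ : Fin n → MatchState} (inv : Invariant x j s₀) where

      s₁ s₂ : Fin n → MatchState
      s₁ = rounds G (phase x j) s₀ 1
      s₂ = rounds G (phase x j) s₀ 2

      acceptor-free : ∀ w {p} → accepted (s₁ w) ≡ just p → Free x (s₀ w)
      acceptor-free w eq = proj₁ (acceptance-just (free? x (s₀ w)) _ eq)

      accepted-proposer : ∀ w {p} → accepted (s₁ w) ≡ just p →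
                          Σ (Fin (deg G w)) λ i → toℕ i ≡ p × Proposes x j (just (s₀ (nbr G w i) , suc (toℕ (back G w i))))
      accepted-proposer w eq with acceptance-just (free? x (s₀ w)) _ eq
      ... | _ , q , q≡p , proposal with lookup (viewG G Δ s₀ w) q in seen≡
      ...   | just (s , b) with lookup-view-just G s₀ w q seen≡
      ...     | i , i≡q , refl , refl = i , trans i≡q q≡p , proposal

      not-accepting : ∀ w → ¬ Free x (s₀ w) → accepted (s₁ w) ≡ nothing
      not-accepting w ¬free with accepted (s₁ w) in eq
      ... | nothing = refl
      ... | just _  = contradiction (acceptor-free w eq) ¬free

      proposal-accepted : ∀ v i → colour (s₀ v) ≡ x → mate (s₀ v) ≡ nothing → toℕ i ≡ j →
                          mate (s₀ (nbr G v i)) ≡ nothing → accepted (s₁ (nbr G v i)) ≢ nothing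
      proposal-accepted v i v≡x v-free i≡j w-free =
        acceptance-yes (free? x (s₀ w)) (any? (proposes? x j ∘ lookup (viewG G Δ s₀ w)))
          (w-free , λ w≡x → colouring-proper G Δ≥deg v i (begin
            finalColour v   ≡⟨ colour≡ inv v ⟨
            colour (s₀ v)   ≡⟨ trans v≡x (sym w≡x) ⟩
            colour (s₀ w)   ≡⟨ colour≡ inv w ⟩
            finalColour w   ∎))
          (inject≤ (back G v i) (Δ≥deg w) ,
           subst (Proposes x j) (sym (lookup-view-port G Δ≥deg w (back G v i)))
             (subst (λ u → colour (s₀ u) ≡ x × mate (s₀ u) ≡ nothing × suc (toℕ (back G w (back G v i))) ≡ suc j)
                    (sym (nbr-back G v i))
                    (v≡x , v-free , cong suc (trans (back-back G v i) i≡j))))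
        where
        open ≡-Reasoning
        w = nbr G v i

      mate-cases : ∀ v {q} → mate (s₂ v) ≡ just q →
                   accepted (s₁ v) ≡ just q ⊎ (q ≡ j × Matches x j (s₁ v) (viewG G Δ s₁ v)) ⊎ mate (s₀ v) ≡ just q
      mate-cases v = settle-cases j (accepted (s₁ v)) (matches? x j (s₁ v) (viewG G Δ s₁ v)) (mate (s₀ v))

      mate-accepted : ∀ v {p} → accepted (s₁ v) ≡ just p → mate (s₂ v) ≡ just p
      mate-accepted v eq = cong (λ a → settle j a (matches? x j (s₁ v) (viewG G Δ s₁ v)) (mate (s₀ v))) eq

      mate-kept : ∀ v {q} → mate (s₀ v) ≡ just q → mate (s₂ v) ≡ just q
      mate-kept v {q} eq = begin
        settle j (accepted (s₁ v)) (matches? x j (s₁ v) (viewG G Δ s₁ v)) (mate (s₀ v))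
          ≡⟨ cong (λ a → settle j a (matches? x j (s₁ v) (viewG G Δ s₁ v)) (mate (s₀ v))) (not-accepting v (matched ∘ proj₁)) ⟩
        settle j nothing (matches? x j (s₁ v) (viewG G Δ s₁ v)) (mate (s₀ v))
          ≡⟨ settle-keeps j (matches? x j (s₁ v) (viewG G Δ s₁ v)) (mate (s₀ v)) (matched ∘ proj₁ ∘ proj₁) ⟩
        mate (s₀ v)
          ≡⟨ eq ⟩
        just q ∎
        where
        open ≡-Reasoning
        matched : mate (s₀ v) ≢ nothing
        matched = just≢nothing ∘ trans (sym eq)

      unmatched-before : ∀ v → mate (s₂ v) ≡ nothing → mate (s₀ v) ≡ nothing
      unmatched-before v unmatched = go (mate (s₀ v)) refl
        where
        go : ∀ m → mate (s₀ v) ≡ m → mate (s₀ v) ≡ nothing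
        go nothing  eq = eq
        go (just _) eq = contradiction (trans (sym (mate-kept v eq)) unmatched) just≢nothing

      matched-stays : ∀ w → mate (s₀ w) ≢ nothing → mate (s₂ w) ≢ nothing
      matched-stays w matched = matched ∘ unmatched-before w

      mate-proposed : ∀ v → colour (s₀ v) ≡ x → mate (s₀ v) ≡ nothing → Accepts (at nothing (viewG G Δ s₁ v) j) →
                      mate (s₂ v) ≡ just j
      mate-proposed v v≡x v-free accepts = trans
        (cong (λ a → settle j a (matches? x j (s₁ v) (viewG G Δ s₁ v)) (mate (s₀ v))) (not-accepting v λ (_ , v≢x) → v≢x v≡x))
        (settle-proposed j (matches? x j (s₁ v) (viewG G Δ s₁ v)) (mate (s₀ v)) ((v-free , v≡x) , accepts))

      accepts-port : ∀ v k → Accepts (at nothing (viewG G Δ s₁ v) k) →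
                     Σ (Fin (deg G v)) λ i → toℕ i ≡ k × accepted (s₁ (nbr G v i)) ≡ just (toℕ (back G v i))
      accepts-port v k accepts with at nothing (viewG G Δ s₁ v) k in seen≡
      ... | just (s , b) with view-just G {Δ = Δ} s₁ v k seen≡
      ...   | i , i≡k , refl , refl = i , i≡k , accepts

      unmatched⇒not-accepted : ∀ w → mate (s₂ w) ≡ nothing → accepted (s₁ w) ≡ nothing
      unmatched⇒not-accepted w unmatched = go (accepted (s₁ w)) refl
        where
        go : ∀ a → accepted (s₁ w) ≡ a → accepted (s₁ w) ≡ nothing
        go nothing  eq = eq
        go (just _) eq = contradiction (trans (sym (mate-accepted w eq)) unmatched) just≢nothing

      phase-invariant : Invariant x (suc j) s₂
      colour≡          phase-invariant = colour≡ inv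
      mate<deg         phase-invariant v eq with mate-cases v eq
      ... | inj₁ accepted≡ = let i , i≡p , _ = accepted-proposer v accepted≡ in subst (_< deg G v) i≡p (toℕ<n i)
      ... | inj₂ (inj₁ (q≡j , _ , accepts)) =
        let i , i≡j , _ = accepts-port v j accepts in subst (_< deg G v) (trans i≡j (sym q≡j)) (toℕ<n i)
      ... | inj₂ (inj₂ kept) = mate<deg inv v kept
      mate-sym         phase-invariant v i eq with mate-cases v eq
      ... | inj₁ accepted≡ with accepted-proposer v accepted≡
      ...   | i' , i'≡i , w≡x , w-free , back≡ with toℕ-injective i'≡i
      ...     | refl = trans (mate-proposed w w≡x w-free accepts) (cong just (sym back≡j))
        where
        w = nbr G v i
        back≡j : toℕ (back G v i) ≡ j
        back≡j = suc-injective back≡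
        accepted-back : Accepts (just (s₁ (nbr G w (back G v i)) , suc (toℕ (back G w (back G v i)))))
        accepted-back = trans (cong (accepted ∘ s₁) (nbr-back G v i)) (trans accepted≡ (cong just (sym (back-back G v i))))
        accepts : Accepts (at nothing (viewG G Δ s₁ w) j)
        accepts = subst (Accepts ∘ at nothing (viewG G Δ s₁ w)) back≡j
                        (subst Accepts (sym (view-port G Δ≥deg w (back G v i))) accepted-back)
      mate-sym         phase-invariant v i eq | inj₂ (inj₁ (i≡j , _ , accepts)) with accepts-port v j accepts
      ... | i' , i'≡j , accepted≡' with toℕ-injective (trans i'≡j (sym i≡j))
      ...   | refl = mate-accepted (nbr G v i) accepted≡'
      mate-sym         phase-invariant v i eq | inj₂ (inj₂ kept) = mate-kept (nbr G v i) (mate-sym inv v i kept)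
      covered-colours  phase-invariant v i c<x unmatched =
        matched-stays (nbr G v i) (covered-colours inv v i c<x (unmatched-before v unmatched))
      covered-ports    phase-invariant v i c≡x i≤j unmatched with m≤n⇒m<n∨m≡n (≤-pred i≤j)
      ... | inj₁ i<j = matched-stays (nbr G v i) (covered-ports inv v i c≡x i<j (unmatched-before v unmatched))
      ... | inj₂ i≡j = λ w-unmatched →
        proposal-accepted v i (trans (colour≡ inv v) c≡x) (unmatched-before v unmatched) i≡j
          (unmatched-before (nbr G v i) w-unmatched) (unmatched⇒not-accepted (nbr G v i) w-unmatched)

    initial-invariant : Invariant 0 0 (matching G 0 0)
    colour≡          initial-invariant v       = refl
    mate<deg         initial-invariant v ()
    mate-sym         initial-invariant v i ()
    covered-colours  initial-invariant v i ()
    covered-ports    initial-invariant v i _ ()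

    next-colour : ∀ {x st} → Invariant x Δ st → Invariant (suc x) 0 st
    colour≡          (next-colour inv) = colour≡ inv
    mate<deg         (next-colour inv) = mate<deg inv
    mate-sym         (next-colour inv) = mate-sym inv
    covered-colours  (next-colour inv) v i c<x+1 with m≤n⇒m<n∨m≡n (≤-pred c<x+1)
    ... | inj₁ c<x = covered-colours inv v i c<x
    ... | inj₂ c≡x = covered-ports inv v i c≡x (<-≤-trans (toℕ<n i) (Δ≥deg v))
    covered-ports    (next-colour inv) v i _ ()

    matching-invariant : ∀ x j → Invariant x j (matching G x j)
    matching-invariant x       (suc j) = Phase.phase-invariant (matching-invariant x j)
    matching-invariant zero    zero    = initial-invariant
    matching-invariant (suc x) zero    = next-colour (matching-invariant x Δ)

    mateOf : Fin n → Maybe ℕ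
    mateOf v = mate (matching G (suc Δ) 0 v)

    final : Invariant (suc Δ) 0 (matching G (suc Δ) 0)
    final = matching-invariant (suc Δ) 0

    matched : Fin n → Fin n → Bool
    matched u v = run G (leadsTo u v (mateOf u))

    matched-partner : ∀ u → mateOf u ≢ nothing → ∃ λ j → matched u (nbr G u j) ≡ true
    matched-partner u matched with mateOf u in eq
    ... | nothing = contradiction refl matched
    ... | just p  = fromℕ< p<deg , subst (λ m → run G (leadsTo u (nbr G u (fromℕ< p<deg)) m) ≡ true)
                                         (cong just (toℕ-fromℕ< p<deg)) (leadsTo-port G u (fromℕ< p<deg))
      where
      p<deg : p < deg G u
      p<deg = mate<deg final u eq

    matched-sym : ∀ u i → matched u (nbr G u i) ≡ true → matched (nbr G u i) u ≡ true
    matched-sym u i eq with leadsTo-true G u (nbr G u i) (mateOf u) eq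
    ... | i' , mate≡ , nbr≡ with simple G u i' i nbr≡
    ...   | refl = subst (λ v → matched (nbr G u i) v ≡ true) (nbr-back G u i)
                         (subst (λ m → run G (leadsTo (nbr G u i) (nbr G (nbr G u i) (back G u i)) m) ≡ true)
                                (sym (mate-sym final u i mate≡)) (leadsTo-port G (nbr G u i) (back G u i)))

    matching-isMaximal : IsMaximalMatching G matched
    proj₁ matching-isMaximal u i = Bool.⇔→≡ {z = true} (mk⇔ (matched-sym u i) from)
      where
      from : matched (nbr G u i) u ≡ true → matched u (nbr G u i) ≡ true
      from eq = subst (λ v → matched v (nbr G u i) ≡ true) (nbr-back G u i)
                  (matched-sym (nbr G u i) (back G u i) (subst (λ v → matched (nbr G u i) v ≡ true) (sym (nbr-back G u i)) eq))
    proj₁ (proj₂ matching-isMaximal) u i i' eq eq'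
      with leadsTo-true G u (nbr G u i) (mateOf u) eq | leadsTo-true G u (nbr G u i') (mateOf u) eq'
    ... | k , mate≡ , nbr≡ | k' , mate≡' , nbr≡' with simple G u k i nbr≡ | simple G u k' i' nbr≡'
    ...   | refl | refl = toℕ-injective (Maybe.just-injective (trans (sym mate≡) mate≡'))
    proj₂ (proj₂ matching-isMaximal) u i _ = go (mateOf u) refl
      where
      go : ∀ m → mateOf u ≡ m →
           (∃ λ j → matched u (nbr G u j) ≡ true) ⊎ (∃ λ j → matched (nbr G u i) (nbr G (nbr G u i) j) ≡ true)
      go (just _) eq = inj₁ (matched-partner u (just≢nothing ∘ trans (sym eq)))
      go nothing  eq = inj₂ (matched-partner (nbr G u i) (covered-colours final u i (colouring-< G Δ≥deg u) eq))

cvCost≤ : ∀ Δ L → suc (Δ * (L * 2 + 3)) ≤ suc Δ * (3 * suc L)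
cvCost≤ Δ L = s≤s (begin
  Δ * (L * 2 + 3)                 ≤⟨ *-monoʳ-≤ Δ (m≤m+n (L * 2 + 3) L) ⟩
  Δ * (L * 2 + 3 + L)             ≡⟨ cong (Δ *_) (thrice L) ⟩
  Δ * (3 * suc L)                 ≤⟨ m≤n+m _ (L + 2 * suc L) ⟩
  L + 2 * suc L + Δ * (3 * suc L) ∎)
  where
  open ≤-Reasoning
  thrice : ∀ m → m * 2 + 3 + m ≡ 3 * suc m
  thrice = solve-∀

-- With Δ = d + 1 the exponent is at most 9Δ² + 10Δ + 2 = 21Δ² − (12d² + 14d); for Δ = 0 both sides are 1.
exponent≤ : ∀ Δ e → e ≤ 2 * (suc Δ * Δ) + suc Δ →
            suc Δ ^ (e + Colouring.reductionRounds Δ * Δ + 1) ≤ suc Δ ^ (21 * (Δ * Δ))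
exponent≤ zero    e _  = ≤-reflexive (trans (^-zeroˡ (e + Colouring.reductionRounds 0 * 0 + 1)) (sym (^-zeroˡ 0)))
exponent≤ (suc d) e e≤ = ^-monoʳ-≤ (2 + d) (begin
  e + (2 + d) * 7 * suc d + 1                                  ≤⟨ +-monoˡ-≤ 1 (+-monoˡ-≤ ((2 + d) * 7 * suc d) e≤) ⟩
  2 * ((2 + d) * suc d) + (2 + d) + (2 + d) * 7 * suc d + 1     ≤⟨ m≤m+n _ (12 * d * d + 14 * d) ⟩
  2 * ((2 + d) * suc d) + (2 + d) + (2 + d) * 7 * suc d + 1
    + (12 * d * d + 14 * d)                                     ≡⟨ slack d ⟩
  21 * (suc d * suc d)                                         ∎)
  where
  open ≤-Reasoning
  slack : ∀ d → 2 * ((2 + d) * suc d) + (2 + d) + (2 + d) * 7 * suc d + 1 + (12 * d * d + 14 * d)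
              ≡ 21 * (suc d * suc d)
  slack = solve-∀

probes≤bound : ∀ Δ L e {p} → e ≤ 2 * (suc Δ * Δ) + suc Δ →
               p ≤ suc Δ ^ e * (suc Δ ^ (Colouring.reductionRounds Δ * Δ) * suc (Δ * (L * 2 + 3))) →
               p ≤ 21 * suc Δ ^ (21 * (Δ * Δ)) * suc L
probes≤bound Δ L e e≤ p≤ = ≤-trans p≤ (begin
  base ^ e * (base ^ (R * Δ) * suc (Δ * (L * 2 + 3))) ≤⟨ *-monoʳ-≤ (base ^ e) (*-monoʳ-≤ (base ^ (R * Δ)) (cvCost≤ Δ L)) ⟩
  base ^ e * (base ^ (R * Δ) * (base * (3 * suc L)))  ≡⟨ powers ⟩
  base ^ (e + R * Δ + 1) * (3 * suc L)                ≤⟨ *-monoˡ-≤ (3 * suc L) (exponent≤ Δ e e≤) ⟩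
  base ^ (21 * (Δ * Δ)) * (3 * suc L)                 ≤⟨ *-monoʳ-≤ (base ^ (21 * (Δ * Δ))) (*-monoˡ-≤ (suc L) (m≤m+n 3 18)) ⟩
  base ^ (21 * (Δ * Δ)) * (21 * suc L)                ≡⟨ rearrange (base ^ (21 * (Δ * Δ))) (suc L) ⟩
  21 * base ^ (21 * (Δ * Δ)) * suc L                  ∎)
  where
  open ≤-Reasoning
  base = suc Δ
  R = Colouring.reductionRounds Δ
  rearrange : ∀ a b → a * (21 * b) ≡ 21 * a * b
  rearrange = solve-∀
  regroup : ∀ a b c y → a * (b * (c * y)) ≡ a * b * (c * 1) * y
  regroup = solve-∀
  powers : base ^ e * (base ^ (R * Δ) * (base * (3 * suc L))) ≡ base ^ (e + R * Δ + 1) * (3 * suc L)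
  powers = begin-equality
    base ^ e * (base ^ (R * Δ) * (base * (3 * suc L))) ≡⟨ regroup (base ^ e) (base ^ (R * Δ)) base (3 * suc L) ⟩
    base ^ e * base ^ (R * Δ) * base ^ 1 * (3 * suc L) ≡⟨ cong (λ z → z * base ^ 1 * (3 * suc L)) (^-distribˡ-+-* base e (R * Δ)) ⟨
    base ^ (e + R * Δ) * base ^ 1 * (3 * suc L)        ≡⟨ cong (_* (3 * suc L)) (^-distribˡ-+-* base (e + R * Δ) 1) ⟨
    base ^ (e + R * Δ + 1) * (3 * suc L)               ∎

module _ (G : Graph n) where

  IsMIS-cong : ∀ {S S′ : Fin n → Bool} → (∀ v → S v ≡ S′ v) → IsMIS G S′ → IsMIS G S
  IsMIS-cong S≡S′ (independent , dominating) =
    (λ v i in-S → trans (S≡S′ _) (independent v i (trans (sym (S≡S′ v)) in-S))) ,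
    (λ v out → let i , in-S′ = dominating v (trans (sym (S≡S′ v)) out) in i , trans (S≡S′ _) in-S′)

  IsMaximalMatching-cong : ∀ {M M′ : Fin n → Fin n → Bool} → (∀ u v → M u v ≡ M′ u v) →
                           IsMaximalMatching G M′ → IsMaximalMatching G M
  IsMaximalMatching-cong M≡M′ (symmetric , unique , maximal) =
    (λ u i → trans (M≡M′ _ _) (trans (symmetric u i) (sym (M≡M′ _ _)))) ,
    (λ u i j m m′ → unique u i j (trans (sym (M≡M′ _ _)) m) (trans (sym (M≡M′ _ _)) m′)) ,
    (λ u i out → Sum.map (map₂ (trans (M≡M′ _ _))) (map₂ (trans (M≡M′ _ _))) (maximal u i (trans (sym (M≡M′ _ _)) out)))

-- colours are below suc Δ, so reducing them modulo suc Δ only changes their type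
colouringAlgorithm : ColoringAlg
colouringAlgorithm n Δ v = (λ s → Colouring.colour s mod suc Δ) <$> Colouring.colouringP Δ Δ v

misAlgorithm : MISAlg
misAlgorithm n Δ v = MaximalIndependentSet.inSet <$> MaximalIndependentSet.misP Δ (suc Δ) v

matchingAlgorithm : MatchingAlg
matchingAlgorithm n Δ u v = MaximalMatching.matchingP Δ (suc Δ) 0 u >>= leadsTo u v ∘ MaximalMatching.mate

module _ {n} Δ (G : Graph n) (Δ≥deg : ∀ v → deg G v ≤ Δ) where
  open Colouring Δ using (colour; colouring; colouringP; run-colouringP; colouring-proper; colouring-<)

  toℕ-run-colouringAlgorithm : ∀ v → toℕ (run G (colouringAlgorithm n Δ v)) ≡ colour (colouring G Δ v)
  toℕ-run-colouringAlgorithm v = begin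
    toℕ (run G (colouringAlgorithm n Δ v))          ≡⟨ cong toℕ (run-<$> G (λ s → colour s mod suc Δ) (colouringP Δ v)) ⟩
    toℕ (colour (run G (colouringP Δ v)) mod suc Δ) ≡⟨ cong (λ s → toℕ (colour s mod suc Δ)) (run-colouringP G Δ v) ⟩
    toℕ (colour (colouring G Δ v) mod suc Δ)        ≡⟨ toℕ-fromℕ< _ ⟩
    colour (colouring G Δ v) % suc Δ                ≡⟨ m<n⇒m%n≡m (colouring-< G Δ≥deg v) ⟩
    colour (colouring G Δ v)                        ∎
    where open ≡-Reasoning

  colouringAlgorithm-proper : IsLegalColoring G (λ v → run G (colouringAlgorithm n Δ v))
  colouringAlgorithm-proper v i eq = colouring-proper G Δ≥deg v i (begin
    colour (colouring G Δ v)                         ≡⟨ toℕ-run-colouringAlgorithm v ⟨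
    toℕ (run G (colouringAlgorithm n Δ v))           ≡⟨ cong toℕ eq ⟩
    toℕ (run G (colouringAlgorithm n Δ (nbr G v i))) ≡⟨ toℕ-run-colouringAlgorithm (nbr G v i) ⟩
    colour (colouring G Δ (nbr G v i))               ∎)
    where open ≡-Reasoning

colouringAlgorithm-correct : ColoringCorrect colouringAlgorithm
colouringAlgorithm-correct n Δ G (Δ≥deg , _) = colouringAlgorithm-proper Δ G Δ≥deg

misAlgorithm-correct : MISCorrect misAlgorithm
misAlgorithm-correct n Δ G (Δ≥deg , _) = IsMIS-cong G run≡ (mis-isMIS G Δ≥deg)
  where
  open MaximalIndependentSet Δ
  run≡ : ∀ v → run G (misAlgorithm n Δ v) ≡ inSet (mis G (suc Δ) v)
  run≡ v = trans (run-<$> G inSet (misP (suc Δ) v)) (cong inSet (run-misP G (suc Δ) v))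

matchingAlgorithm-correct : MatchingCorrect matchingAlgorithm
matchingAlgorithm-correct n Δ G (Δ≥deg , _) = IsMaximalMatching-cong G run≡ (matching-isMaximal G Δ≥deg)
  where
  open MaximalMatching Δ
  run≡ : ∀ u v → run G (matchingAlgorithm n Δ u v) ≡ matched G Δ≥deg u v
  run≡ u v = trans (run->>= G (matchingP (suc Δ) 0 u) _)
                   (cong (λ s → run G (leadsTo u v (mate s))) (run-matchingP G (suc Δ) 0 u))

colouringAlgorithm-probes : ColoringProbes≤ colouringAlgorithm (bound 21)
colouringAlgorithm-probes n Δ G _ v = probes≤bound Δ (log* n) 0 z≤n (begin
  probes G (colouringAlgorithm n Δ v)  ≡⟨ probes-<$> G _ (colouringP Δ v) ⟩
  probes G (colouringP Δ v)            ≤⟨ n≤1+n _ ⟩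
  suc (probes G (colouringP Δ v))      ≤⟨ probes-colouringP G Δ v ⟩
  Q                                    ≡⟨ *-identityˡ Q ⟨
  suc Δ ^ 0 * Q                        ∎)
  where
  open Colouring Δ using (colouringP; probes-colouringP; reductionRounds)
  open ≤-Reasoning
  Q = suc Δ ^ (reductionRounds * Δ) * suc (Δ * cvRounds n)

misAlgorithm-probes : MISProbes≤ misAlgorithm (bound 21)
misAlgorithm-probes n Δ G _ v = probes≤bound Δ (log* n) (suc Δ) (m≤n+m (suc Δ) _) (begin
  probes G (misAlgorithm n Δ v)   ≡⟨ probes-<$> G _ (misP (suc Δ) v) ⟩
  probes G (misP (suc Δ) v)       ≤⟨ n≤1+n _ ⟩
  suc (probes G (misP (suc Δ) v)) ≤⟨ probes-misP G (suc Δ) v ⟩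
  suc Δ ^ suc Δ * Q               ∎)
  where
  open MaximalIndependentSet Δ
  open ≤-Reasoning
  Q = suc Δ ^ (Colouring.reductionRounds Δ * Δ) * suc (Δ * cvRounds n)

matchingAlgorithm-probes : MatchingProbes≤ matchingAlgorithm (bound 21)
matchingAlgorithm-probes n Δ G _ u i =
  probes≤bound Δ (log* n) (2 * (suc Δ * Δ + 0)) phases≤ (begin
    probes G (matchingAlgorithm n Δ u w)                         ≡⟨ probes->>= G (matchingP (suc Δ) 0 u) _ ⟩
    probes G (matchingP (suc Δ) 0 u) + probes G (leadsTo u w _) ≤⟨ +-monoʳ-≤ _ (probes-leadsTo G u w _) ⟩
    probes G (matchingP (suc Δ) 0 u) + 1                         ≡⟨ +-comm _ 1 ⟩
    suc (probes G (matchingP (suc Δ) 0 u))                       ≤⟨ probes-matchingP G (suc Δ) 0 u ⟩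
    suc Δ ^ (2 * (suc Δ * Δ + 0)) * Q                            ∎)
  where
  open MaximalMatching Δ
  open ≤-Reasoning
  w = nbr G u i
  Q = suc Δ ^ (Colouring.reductionRounds Δ * Δ) * suc (Δ * cvRounds n)
  phases≤ : 2 * (suc Δ * Δ + 0) ≤ 2 * (suc Δ * Δ) + suc Δ
  phases≤ = ≤-trans (≤-reflexive (cong (2 *_) (+-identityʳ (suc Δ * Δ)))) (m≤m+n _ (suc Δ))

corollary13 :
    (∃[ c ] ∃[ A ] (ColoringCorrect A × ColoringProbes≤ A (bound c))) ×
    (∃[ c ] ∃[ A ] (MISCorrect A × MISProbes≤ A (bound c))) ×
    (∃[ c ] ∃[ A ] (MatchingCorrect A × MatchingProbes≤ A (bound c)))
corollary13 =
  (21 , colouringAlgorithm , colouringAlgorithm-correct , colouringAlgorithm-probes) ,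
  (21 , misAlgorithm       , misAlgorithm-correct       , misAlgorithm-probes) ,
  (21 , matchingAlgorithm  , matchingAlgorithm-correct  , matchingAlgorithm-probes)
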